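{- Let $G=(V_G,E_G)$ and $H=(V_H,E_H)$ be finite simple connected graphs with $|V_G|=n$, $|V_H|=m$, $V_G=\{x_1,\dots,x_n\}$. Let $u=(y_1,\ldots,y_n)x\in V_{G\wr H}$ and $p=\frac{m-1}{m}$. Then $u$ is median in $G\wr H$ if and only if $y_1,\dots,y_n$ are all median in $H$ and $x$ is $p$TS-median in $G$. In particular, $G\wr H$ is distance-balanced if and only if $G$ is $p$TS-distance-balanced and $H$ is distance-balanced.
   Context: For a graph $K$ of order $N$, $d_K(u)=\frac1N\sum_{v}d_K(u,v)$ (geodesic distance); $u$ is median if $d_K(u)=\min_v d_K(v)$. $K$ is distance-balanced if for every edge $uv$, $|\{z:d_K(z,u)<d_K(z,v)\}|=|\{z:d_K(z,v)<d_K(z,u)\}|$. For $A\subseteq V_G$, $\rho_A(u,v)$ is the length of a shortest walk in $G$ from $u$ to $v$ visiting every vertex of $A$; $p_A=p^{|A|}(1-p)^{n-|A|}$; $d_G^p(u)=\frac1n\sum_{v}\sum_{A\subseteq V_G}p_A\rho_A(u,v)$; $x$ is $p$TS-median if $d_G^p(x)=\min_v d_G^p(v)$. For edges $uv$ of $G$, $W^A_{uv}=\{z:\rho_A(z,u)<\rho_A(z,v)\}$, $w^p_{uv}=\sum_A p_A|W^A_{uv}|$; $G$ is $p$TS-distance-balanced if $w^p_{uv}=w^p_{vu}$ for every edge $uv$. The wreath product $G\wr H$ has vertex set $\{(y_1,\dots,y_n)x_i: y_j\in V_H, x_i\in V_G\}$ with $(y_1,\dots,y_n)x_i\sim(y'_1,\dots,y'_n)x_k$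 iff either ($i=k$, $y_j=y'_j$ for $j\ne i$, $y_i\sim y'_i$ in $H$) or ($y_j=y'_j$ for all $j$ and $x_i\sim x_k$ in $G$). -}

module Defs where

open import Data.Bool using (Bool; true; false; _∧_; _∨_; if_then_else_)
open import Data.Nat as ℕ using (ℕ; zero; suc; _≡ᵇ_; _<ᵇ_)
open import Data.Fin as Fin using (Fin)
open import Data.Fin.Subset using (Subset; ⁅_⁆; _─_; ∣_∣)
open import Data.Vec as Vec using (Vec; []; _∷_; lookup)
open import Data.Vec.Properties as VecP using ()
open import Data.List as List using (List; _∷_; []; map; concatMap; allFin; foldr; length)
open import Data.Bool.ListAction using (any; all)
open import Data.Product using (_×_; _,_; Σ; ∃)
open import Data.Product.Properties as ProdP using ()
open import Data.Integer using (+_)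
open import Data.Rational as ℚ using (ℚ; 0ℚ; 1ℚ; _+_; _*_; _/_; _≤_)
open import Relation.Binary.PropositionalEquality using (_≡_; _≢_)
open import Relation.Binary.Definitions using (DecidableEquality)
open import Relation.Nullary using (does)
open import Function.Bundles using (_⇔_)

record SimpleGraph (n : ℕ) : Set where
  field
    adj     : Fin n → Fin n → Bool
    adj-sym : ∀ u v → adj u v ≡ adj v u
    adj-irr : ∀ v → adj v v ≡ false
open SimpleGraph public

-- A general finite graph: vertex type with decidable equality and a list
-- enumerating every vertex exactly once (used for G, H and G ≀ H).
record FinGraph : Set₁ where
  field
    V     : Set
    _≟V_  : DecidableEquality V
    verts : List V
    Adj   : V → V → Bool
open FinGraph public

toFG : ∀ {n} → SimpleGraph n → FinGraph
toFG {n} G = record { V = Fin n ; _≟V_ = Fin._≟_ ; verts = allFin n ; Adj = adj G }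

data Walk (K : FinGraph) : V K → V K → Set where
  nil  : ∀ {u} → Walk K u u
  cons : ∀ {u w v} → Adj K u w ≡ true → Walk K w v → Walk K u v

Connected : FinGraph → Set
Connected K = ∀ u v → Walk K u v

-- least i < b with f i ≡ true; returns b if there is none
search : (ℕ → Bool) → ℕ → ℕ
search f zero    = zero
search f (suc b) = if f 0 then 0 else suc (search (λ i → f (suc i)) b)

count : ∀ {A : Set} → (A → Bool) → List A → ℕ
count p []       = 0
count p (x ∷ xs) = (if p x then 1 else 0) ℕ.+ count p xs

sumℚ : ∀ {A : Set} → (A → ℚ) → List A → ℚ
sumℚ f = foldr (λ a r → f a + r) 0ℚ

sumℕ : ∀ {A : Set} → (A → ℕ) → List A → ℕ
sumℕ f = foldr (λ a r → f a ℕ.+ r) 0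

ℕtoℚ : ℕ → ℚ
ℕtoℚ k = + k / 1

-- 1 / N  (N is never 0 where used)
inv : ℕ → ℚ
inv zero    = 0ℚ
inv (suc k) = + 1 / suc k

powℚ : ℚ → ℕ → ℚ
powℚ q zero    = 1ℚ
powℚ q (suc k) = q * powℚ q k

module _ (K : FinGraph) where

  reach : ℕ → V K → V K → Bool
  reach zero    u v = does ((_≟V_ K) u v)
  reach (suc k) u v = any (λ w → Adj K u w ∧ reach k w v) (verts K)

  -- d_K(u,v): length of a shortest walk (= geodesic distance for connected K)
  dist : V K → V K → ℕ
  dist u v = search (λ k → reach k u v) (length (verts K))

  avgDist : V K → ℚ
  avgDist u = inv (length (verts K)) * ℕtoℚ (sumℕ (λ v → dist u v) (verts K))

  IsMedian : V K → Set
  IsMedian u = ∀ v → avgDist u ≤ avgDist v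

  Wcount : V K → V K → ℕ
  Wcount u v = count (λ z → dist z u <ᵇ dist z v) (verts K)

  DistanceBalanced : Set
  DistanceBalanced = ∀ u v → Adj K u v ≡ true → Wcount u v ≡ Wcount v u

allSubsets : ∀ n → List (Subset n)
allSubsets zero    = [] ∷ []
allSubsets (suc n) = concatMap (λ b → map (b ∷_) (allSubsets n)) (true ∷ false ∷ [])

module _ {n : ℕ} (G : SimpleGraph n) where

  -- there is a walk of length exactly k from u to v visiting every vertex of A
  cover : ℕ → Fin n → Subset n → Fin n → Bool
  cover zero    u A v = does (u Fin.≟ v) ∧ (∣ A ─ ⁅ u ⁆ ∣ ≡ᵇ 0)
  cover (suc k) u A v = any (λ w → adj G u w ∧ cover k w (A ─ ⁅ u ⁆) v) (allFin n)

  -- ρ_A(u,v): length of a shortest such walk (one of length < n*n+n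
  -- exists whenever G is connected)
  ρ : Subset n → Fin n → Fin n → ℕ
  ρ A u v = search (λ k → cover k u A v) (n ℕ.* n ℕ.+ n)

  pA : ℚ → Subset n → ℚ
  pA p A = powℚ p ∣ A ∣ * powℚ (1ℚ ℚ.- p) (n ℕ.∸ ∣ A ∣)

  tsDist : ℚ → Fin n → ℚ
  tsDist p u = inv n * sumℚ (λ v → sumℚ (λ A → pA p A * ℕtoℚ (ρ A u v)) (allSubsets n)) (allFin n)

  IsPTSMedian : ℚ → Fin n → Set
  IsPTSMedian p x = ∀ v → tsDist p x ≤ tsDist p v

  wp : ℚ → Fin n → Fin n → ℚ
  wp p u v = sumℚ (λ A → pA p A * ℕtoℚ (count (λ z → ρ A z u <ᵇ ρ A z v) (allFin n))) (allSubsets n)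

  PTSDistanceBalanced : ℚ → Set
  PTSDistanceBalanced p = ∀ u v → adj G u v ≡ true → wp p u v ≡ wp p v u

allVecs : ∀ m n → List (Vec (Fin m) n)
allVecs m zero    = [] ∷ []
allVecs m (suc n) = concatMap (λ y → map (y ∷_) (allVecs m n)) (allFin m)

module _ {n m : ℕ} (G : SimpleGraph n) (H : SimpleGraph m) where

  private
    eqV : DecidableEquality (Vec (Fin m) n × Fin n)
    eqV = ProdP.≡-dec (VecP.≡-dec Fin._≟_) Fin._≟_

    agreeOff : Fin n → Vec (Fin m) n → Vec (Fin m) n → Bool
    agreeOff i ys zs = all (λ j → does (j Fin.≟ i) ∨ does (lookup ys j Fin.≟ lookup zs j)) (allFin n)

  wreathAdj : Vec (Fin m) n × Fin n → Vec (Fin m) n × Fin n → Bool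
  wreathAdj (ys , i) (zs , k) =
      (does (i Fin.≟ k) ∧ agreeOff i ys zs ∧ adj H (lookup ys i) (lookup zs i))
    ∨ (does (VecP.≡-dec Fin._≟_ ys zs) ∧ adj G i k)

  _≀_ : FinGraph
  _≀_ = record
    { V     = Vec (Fin m) n × Fin n
    ; _≟V_  = eqV
    ; verts = concatMap (λ ys → map (ys ,_) (allFin n)) (allVecs m n)
    ; Adj   = wreathAdj
    }

-- A shortest walk in G ≀ H from (y , x) to (z , x′) must visit, in G, every coordinate j with
-- y_j ≠ z_j (a coordinate can only be changed while standing on it), and it changes each of
-- them along a geodesic of H. Hence, with D = {j : y_j ≠ z_j},
--   d((y , x) , (z , x′)) = ρ_D(x , x′) + Σ_j d_H(y_j , z_j).
-- Summing over z, each A ⊆ V_G occurs as D for exactly (m−1)^|A| vectors z, and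
-- (m−1)^|A| = m^n p_A for p = (m−1)/m. So the total distance of (y , x) is a positive multiple
-- of d^p_G(x) plus a positive multiple of Σ_j d_H(y_j), and the two summands are minimised
-- independently. The same bookkeeping, for an edge along G, turns |W_uv| in G ≀ H into a
-- multiple of w^p_uv; for an edge along H at coordinate i, ρ_D(x′ , i) does not see whether
-- i ∈ D, so |W_uv| becomes n m^(n−1) times the corresponding count in H.

module Submission where

open import Defs
open import Data.Bool using (Bool; true; false; _∧_; _∨_; not; if_then_else_)
open import Data.Bool.Properties using (T-≡; ∧-conicalˡ; ∧-conicalʳ; ∨-zeroʳ)
open import Data.Bool.ListAction using (any; all)
open import Data.Nat using (ℕ; zero; suc; _+_; _*_; _∸_; _^_; _≤_; _<_; z≤n; s≤s; z<s; _≡ᵇ_; _<ᵇ_; NonZero)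
open import Data.Nat.Induction using (<-rec)
open import Data.Nat.Properties
open import Data.Nat.Tactic.RingSolver using (solve-∀)
open import Data.Fin as F using (Fin; toℕ; punchIn)
open import Data.Fin.Properties using (pigeonhole; toℕ≤pred[n]; punchInᵢ≢i)
open import Data.Fin.Subset using (Subset; ⁅_⁆; _-_; _∪_; ∣_∣; _∈_; _∉_; _⊆_; Empty)
open import Data.Fin.Subset.Properties
  using (x∈⁅x⁆; x∈⁅y⁆⇒x≡y; x∈p∪q⁺; x∈p∪q⁻; p─q⊆p; x∈p∧x≢y⇒x∈p-y; x∈p⇒∣p-x∣<∣p∣;
         Empty-unique; ∣⊥∣≡0; ∣p∣≤n)
open import Data.Vec as Vec using (Vec; []; _∷_; here; there; lookup; _[_]≔_)
open import Data.Vec.Properties as VecP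
  using (lookup∘update; lookup∘update′; []≔-idempotent; []≔-lookup; lookup-zipWith; []=⇒lookup; lookup⇒[]=;
         tabulate∘lookup; tabulate-cong; zipWith-comm)
open import Data.Vec.Functional using (removeAt)
import Data.List
open import Data.List using (List; []; _∷_; length; allFin; map; concatMap; tabulate; _++_)
open import Data.List.Properties using (length-tabulate)
open import Data.List.Membership.Propositional using (find; lose) renaming (_∈_ to _∈ₗ_)
open import Data.List.Membership.Propositional.Properties using (∈-allFin; ∈-map⁺; ∈-concatMap⁺)
open import Data.List.Relation.Unary.All as All using (All; []; _∷_)
open import Data.List.Relation.Unary.All.Properties using (all⁺; all⁻)
open import Data.List.Relation.Unary.Any using (here; index)
open import Data.List.Relation.Unary.Any.Properties using (any⁺; any⁻; lookup-index)
open import Data.Product using (Σ; ∃; _×_; _,_; proj₁; proj₂)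
open import Data.Sum using (_⊎_; inj₁; inj₂)
open import Data.Integer using (+_)
import Data.Integer as ℤ
import Data.Integer.Properties as ℤ
import Data.Integer.Tactic.RingSolver as ℤ
open import Data.Rational as ℚ using (ℚ; 1ℚ; _/_; Positive; toℚᵘ)
import Data.Rational.Properties as ℚ
open import Data.Rational.Unnormalised as ℚᵘ using (mkℚᵘ; *≡*; *≤*)
import Data.Rational.Unnormalised.Properties as ℚᵘ
open import Algebra.Bundles using (CommutativeMonoid)
open import Algebra.Properties.CommutativeSemigroup (CommutativeMonoid.commutativeSemigroup ℚ.*-1-commutativeMonoid)
  using (interchange)
open import Algebra.Properties.Semiring.Sum +-*-semiring using (sum; sum-cong-≗; sum-remove; sum-replicate-zero)
open import Function using (_∘_; id)
open import Function.Bundles using (_⇔_; mk⇔; Equivalence)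
open import Relation.Nullary using (Dec; yes; no; does; contradiction)
open import Relation.Nullary.Decidable using (dec-true; dec-false; does-⇔)
open import Relation.Binary.PropositionalEquality

∨-true⁻ : ∀ a {b} → a ∨ b ≡ true → a ≡ true ⊎ b ≡ true
∨-true⁻ true  _ = inj₁ refl
∨-true⁻ false e = inj₂ e

∨-trueˡ : ∀ {a} b → a ≡ true → a ∨ b ≡ true
∨-trueˡ b refl = refl

module _ {A : Set} (p : A → Bool) where

  any-true⁻ : ∀ xs → any p xs ≡ true → ∃ λ x → x ∈ₗ xs × p x ≡ true
  any-true⁻ xs e with find (any⁻ p xs (Equivalence.from T-≡ e))
  ... | x , x∈xs , px = x , x∈xs , Equivalence.to T-≡ px

  any-true⁺ : ∀ {x} xs → x ∈ₗ xs → p x ≡ true → any p xs ≡ true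
  any-true⁺ xs x∈xs px = Equivalence.to T-≡ (any⁺ p (lose x∈xs (Equivalence.from T-≡ px)))

  all-true⁻ : ∀ xs → all p xs ≡ true → ∀ {x} → x ∈ₗ xs → p x ≡ true
  all-true⁻ xs e x∈xs = Equivalence.to T-≡ (All.lookup (all⁺ p xs (Equivalence.from T-≡ e)) x∈xs)

  all-true⁺ : ∀ xs → (∀ {x} → x ∈ₗ xs → p x ≡ true) → all p xs ≡ true
  all-true⁺ xs f = Equivalence.to T-≡ (all⁻ p (All.tabulate (λ x∈xs → Equivalence.from T-≡ (f x∈xs))))

does-true⁻ : ∀ {A : Set} (d : Dec A) → does d ≡ true → A
does-true⁻ (yes a) _ = a

search-minimal : ∀ (f : ℕ → Bool) b k → f k ≡ true → search f b ≤ k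
search-minimal f zero    k       _ = z≤n
search-minimal f (suc b) zero    e with f 0
search-minimal f (suc b) zero    _  | true = z≤n
search-minimal f (suc b) zero    () | false
search-minimal f (suc b) (suc k) e with f 0
... | true  = z≤n
... | false = s≤s (search-minimal (λ i → f (suc i)) b k e)

search-sound : ∀ (f : ℕ → Bool) b k → k < b → f k ≡ true → f (search f b) ≡ true
search-sound f (suc b) zero    _         e with f 0 in e₀
search-sound f (suc b) zero    _         _  | true  = e₀
search-sound f (suc b) zero    _         () | false
search-sound f (suc b) (suc k) (s≤s k<b) e with f 0 in e₀
... | true  = e₀
... | false = search-sound (λ i → f (suc i)) b k k<b e

-- does (m <? n) reduces to m <ᵇ n, so does-⇔ compares the boolean tests directly.
<ᵇ-shift : ∀ a b c d → a + d ≡ b + c → (a <ᵇ b) ≡ (c <ᵇ d)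
<ᵇ-shift a b c d a+d≡b+c = does-⇔ (mk⇔ to from) (a <? b) (c <? d)
  where
  to : a < b → c < d
  to a<b = +-cancelˡ-< b c d (subst (_< b + d) a+d≡b+c (+-monoˡ-< d a<b))
  from : c < d → a < b
  from c<d = +-cancelʳ-< d a b (subst (_< b + d) (sym a+d≡b+c) (+-monoʳ-< b c<d))

-- Walks of a given length and geodesic distance

length-allFin : ∀ k → length (allFin k) ≡ k
length-allFin k = length-tabulate id

data LWalk (K : FinGraph) : ℕ → V K → V K → Set where
  nil  : ∀ {u} → LWalk K 0 u u
  cons : ∀ {k u w v} → Adj K u w ≡ true → LWalk K k w v → LWalk K (suc k) u v

module _ {K : FinGraph} where

  _++ʷ_ : ∀ {a b u w v} → LWalk K a u w → LWalk K b w v → LWalk K (a + b) u v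
  nil      ++ʷ q = q
  cons e p ++ʷ q = cons e (p ++ʷ q)

  toLWalk : ∀ {u v} → Walk K u v → ∃ λ k → LWalk K k u v
  toLWalk nil        = 0 , nil
  toLWalk (cons e w) with toLWalk w
  ... | k , p = suc k , cons e p

  reach-sound : ∀ k u v → reach K k u v ≡ true → LWalk K k u v
  reach-sound zero    u v e rewrite does-true⁻ (_≟V_ K u v) e = nil
  reach-sound (suc k) u v e with any-true⁻ (λ w → Adj K u w ∧ reach K k w v) (verts K) e
  ... | w , _ , e′ = cons (∧-conicalˡ _ _ e′) (reach-sound k w v (∧-conicalʳ _ _ e′))

  vertexAt : ∀ {k u v} → LWalk K k u v → ℕ → V K
  vertexAt {u = u} nil        _       = u
  vertexAt {u = u} (cons _ p) zero    = u
  vertexAt         (cons _ p) (suc i) = vertexAt p i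

  vertexAt-zero : ∀ {k u v} (p : LWalk K k u v) → vertexAt p 0 ≡ u
  vertexAt-zero nil        = refl
  vertexAt-zero (cons _ p) = refl

  takeʷ : ∀ {k u v} (p : LWalk K k u v) i → i ≤ k → LWalk K i u (vertexAt p i)
  takeʷ p          zero    _         rewrite vertexAt-zero p = nil
  takeʷ (cons e p) (suc i) (s≤s i≤k) = cons e (takeʷ p i i≤k)

  dropʷ : ∀ {k u v} (p : LWalk K k u v) i → i ≤ k → LWalk K (k ∸ i) (vertexAt p i) v
  dropʷ p          zero    _         rewrite vertexAt-zero p = p
  dropʷ (cons _ p) (suc i) (s≤s i≤k) = dropʷ p i i≤k

module _ (K : FinGraph) (complete : ∀ v → v ∈ₗ verts K) where

  private
    N : ℕ
    N = length (verts K)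

  reach-complete : ∀ {k u v} → LWalk K k u v → reach K k u v ≡ true
  reach-complete {u = u} nil = dec-true (_≟V_ K u u) refl
  reach-complete {suc k} {u} {v} (cons {w = w} e p) =
    any-true⁺ (λ w → Adj K u w ∧ reach K k w v) (verts K) (complete w)
      (cong₂ _∧_ e (reach-complete p))

  -- A walk with at least N steps repeats a vertex (pigeonhole on the index
  -- of the visited vertex in verts K); cutting out the loop shortens it.
  shortcut : ∀ {k u v} → LWalk K k u v → N ≤ k → ∃ λ k′ → k′ < k × LWalk K k′ u v
  shortcut {k} {u} {v} p N≤k
    with pigeonhole (s≤s N≤k) (λ t → index (complete (vertexAt p (toℕ t))))
  ... | i , j , i<j , same-index =
    toℕ i + (k ∸ toℕ j) , shorter ,
    takeʷ p (toℕ i) i≤k ++ʷ subst (λ x → LWalk K (k ∸ toℕ j) x v) (sym loop) (dropʷ p (toℕ j) j≤k)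
    where
    j≤k : toℕ j ≤ k
    j≤k = toℕ≤pred[n] j
    i≤k : toℕ i ≤ k
    i≤k = ≤-trans (<⇒≤ i<j) j≤k
    loop : vertexAt p (toℕ i) ≡ vertexAt p (toℕ j)
    loop = trans (lookup-index (complete _))
                 (trans (cong (Data.List.lookup (verts K)) same-index) (sym (lookup-index (complete _))))
    shorter : toℕ i + (k ∸ toℕ j) < k
    shorter = begin-strict
      toℕ i + (k ∸ toℕ j) <⟨ +-monoˡ-< (k ∸ toℕ j) i<j ⟩
      toℕ j + (k ∸ toℕ j) ≡⟨ m+[n∸m]≡n j≤k ⟩
      k                   ∎
      where open ≤-Reasoning

  shortest : ∀ {k u v} → LWalk K k u v → ∃ λ k′ → k′ < N × LWalk K k′ u v
  shortest {k} = <-rec Shortenable shorten k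
    where
    Shortenable : ℕ → Set
    Shortenable k = ∀ {u v} → LWalk K k u v → ∃ λ k′ → k′ < N × LWalk K k′ u v
    shorten : ∀ k → (∀ {k′} → k′ < k → Shortenable k′) → Shortenable k
    shorten k rec p with N ≤? k
    ... | no  N≰k = k , ≰⇒> N≰k , p
    ... | yes N≤k with shortcut p N≤k
    ...   | k′ , k′<k , q = rec k′<k q

  dist-minimal : ∀ {k u v} → LWalk K k u v → dist K u v ≤ k
  dist-minimal {k} {u} {v} p = search-minimal (λ i → reach K i u v) N k (reach-complete p)

  dist-attained : ∀ {k u v} → LWalk K k u v → LWalk K (dist K u v) u v
  dist-attained {u = u} {v} p with shortest p
  ... | k , k<N , q = reach-sound _ u v (search-sound (λ i → reach K i u v) N k k<N (reach-complete q))

-- Covering walks and the travelling-salesman distance ρ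

x∉p-x : ∀ {n} (p : Subset n) x → x ∉ p - x
x∉p-x (_ ∷ p) F.zero    ()
x∉p-x (_ ∷ p) (F.suc x) (there x∈p) = x∉p-x p x x∈p

module _ {n : ℕ} (G : SimpleGraph n) where

  visited : ∀ {k u v} → LWalk (toFG G) k u v → Subset n
  visited {u = u} nil        = ⁅ u ⁆
  visited {u = u} (cons _ p) = ⁅ u ⁆ ∪ visited p

  start∈visited : ∀ {k u v} (p : LWalk (toFG G) k u v) → u ∈ visited p
  start∈visited {u = u} nil        = x∈⁅x⁆ u
  start∈visited {u = u} (cons _ p) = x∈p∪q⁺ (inj₁ (x∈⁅x⁆ u))

  end∈visited : ∀ {k u v} (p : LWalk (toFG G) k u v) → v ∈ visited p
  end∈visited nil        = start∈visited nil
  end∈visited (cons _ p) = x∈p∪q⁺ (inj₂ (end∈visited p))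

  cover-sound : ∀ k u A v → cover G k u A v ≡ true → Σ (LWalk (toFG G) k u v) λ p → A ⊆ visited p
  cover-sound zero    u A v e with does-true⁻ (u F.≟ v) (∧-conicalˡ _ _ e)
  ... | refl = nil , A⊆⁅u⁆
    where
    A-u-empty : ∣ A - u ∣ ≡ 0
    A-u-empty = ≡ᵇ⇒≡ _ 0 (Equivalence.from T-≡ (∧-conicalʳ _ _ e))
    A⊆⁅u⁆ : A ⊆ ⁅ u ⁆
    A⊆⁅u⁆ {j} j∈A with j F.≟ u
    ... | yes refl = x∈⁅x⁆ j
    ... | no  j≢u  = contradiction (subst (∣ A - u - j ∣ <_) A-u-empty (x∈p⇒∣p-x∣<∣p∣ (x∈p∧x≢y⇒x∈p-y j∈A j≢u))) n≮0
  cover-sound (suc k) u A v e with any-true⁻ (λ w → adj G u w ∧ cover G k w (A - u) v) (allFin n) e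
  ... | w , _ , e′ with cover-sound k w (A - u) v (∧-conicalʳ _ _ e′)
  ... | p , A-u⊆p = cons (∧-conicalˡ _ _ e′) p , A⊆
    where
    A⊆ : A ⊆ ⁅ u ⁆ ∪ visited p
    A⊆ {j} j∈A with j F.≟ u
    ... | yes refl = x∈p∪q⁺ (inj₁ (x∈⁅x⁆ j))
    ... | no  j≢u  = x∈p∪q⁺ (inj₂ (A-u⊆p (x∈p∧x≢y⇒x∈p-y j∈A j≢u)))

  cover-complete : ∀ {k u v A} (p : LWalk (toFG G) k u v) → A ⊆ visited p → cover G k u A v ≡ true
  cover-complete {u = u} {A = A} nil A⊆⁅u⁆ =
    cong₂ _∧_ (dec-true (u F.≟ u) refl) (cong (_≡ᵇ 0) (trans (cong ∣_∣ (Empty-unique A-u-empty)) (∣⊥∣≡0 n)))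
    where
    A-u-empty : Empty (A - u)
    A-u-empty (j , j∈A-u) with x∈⁅y⁆⇒x≡y u (A⊆⁅u⁆ (p─q⊆p A ⁅ u ⁆ j∈A-u))
    ... | refl = x∉p-x A j j∈A-u
  cover-complete {suc k} {u} {v} {A} (cons {w = w} e p) A⊆ =
    any-true⁺ (λ w → adj G u w ∧ cover G k w (A - u) v) (allFin n) (∈-allFin w)
      (cong₂ _∧_ e (cover-complete p A-u⊆))
    where
    A-u⊆ : A - u ⊆ visited p
    A-u⊆ {j} j∈A-u with x∈p∪q⁻ ⁅ u ⁆ (visited p) (A⊆ (p─q⊆p A ⁅ u ⁆ j∈A-u))
    ... | inj₂ j∈p  = j∈p
    ... | inj₁ j∈⁅u⁆ with x∈⁅y⁆⇒x≡y u j∈⁅u⁆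
    ...   | refl = contradiction j∈A-u (x∉p-x A j)

  ρ-minimal : ∀ {k u v A} (p : LWalk (toFG G) k u v) → A ⊆ visited p → ρ G A u v ≤ k
  ρ-minimal {k} {u} {v} {A} p A⊆p = search-minimal (λ i → cover G i u A v) (n * n + n) k (cover-complete p A⊆p)

  visited-++ʳ : ∀ {a b u w v} (p : LWalk (toFG G) a u w) (q : LWalk (toFG G) b w v) → visited q ⊆ visited (p ++ʷ q)
  visited-++ʳ nil        q j∈q = j∈q
  visited-++ʳ (cons _ p) q j∈q = x∈p∪q⁺ (inj₂ (visited-++ʳ p q j∈q))

module _ {n′ : ℕ} (G : SimpleGraph (suc n′)) (connected : Connected (toFG G)) where

  private
    n : ℕ
    n = suc n′

  short-walk : ∀ u v → ∃ λ k → k ≤ n′ × LWalk (toFG G) k u v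
  short-walk u v with shortest (toFG G) ∈-allFin (proj₂ (toLWalk (connected u v)))
  ... | k , k<N , p = k , ≤-pred (subst (k <_) (length-allFin n) k<N) , p

  tour : ∀ (L : List (Fin n)) u v →
         ∃ λ k → k ≤ (length L + 1) * n′ × Σ (LWalk (toFG G) k u v) λ p → All (_∈ visited G p) L
  tour []      u v with short-walk u v
  ... | k , k≤n′ , p = k , ≤-trans k≤n′ (≤-reflexive (sym (+-identityʳ n′))) , p , []
  tour (a ∷ L) u v with short-walk u a | tour L a v
  ... | k₁ , k₁≤ , p₁ | k₂ , k₂≤ , p₂ , L⊆p₂ =
    k₁ + k₂ , +-mono-≤ k₁≤ k₂≤ , p₁ ++ʷ p₂ ,
    visited-++ʳ G p₁ p₂ (start∈visited G p₂) ∷ All.map (visited-++ʳ G p₁ p₂) L⊆p₂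

  covering-walk : ∀ u A v → ∃ λ k → k < n * n + n × Σ (LWalk (toFG G) k u v) λ p → A ⊆ visited G p
  covering-walk u A v with tour (allFin n) u v
  ... | k , k≤ , p , all∈p =
    k , ≤-<-trans (subst (λ l → k ≤ (l + 1) * n′) (length-allFin n) k≤) (tour-bound n′) ,
    p , λ {j} _ → All.lookup all∈p (∈-allFin j)
    where
    tour-bound : ∀ m → (suc m + 1) * m < suc m * suc m + suc m
    tour-bound m = <-≤-trans (m<m+n _ z<s) (≤-reflexive (tour-bound-≡ m))
      where
      tour-bound-≡ : ∀ m → (suc m + 1) * m + (suc m + 1) ≡ suc m * suc m + suc m
      tour-bound-≡ = solve-∀

  ρ-attained : ∀ A u v → Σ (LWalk (toFG G) (ρ G A u v) u v) λ p → A ⊆ visited G p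
  ρ-attained A u v with covering-walk u A v
  ... | k , k<bound , p , A⊆p =
    cover-sound G _ u A v (search-sound (λ i → cover G i u A v) (n * n + n) k k<bound (cover-complete G p A⊆p))

  -- every walk visits its endpoint, so the endpoint's membership in A is irrelevant
  ρ-mono-end : ∀ {A B} u v → A ⊆ B ∪ ⁅ v ⁆ → ρ G A u v ≤ ρ G B u v
  ρ-mono-end {A} {B} u v A⊆B+v with ρ-attained B u v
  ... | p , B⊆p = ρ-minimal G p A⊆p
    where
    A⊆p : A ⊆ visited G p
    A⊆p j∈A with x∈p∪q⁻ B ⁅ v ⁆ (A⊆B+v j∈A)
    ... | inj₁ j∈B  = B⊆p j∈B
    ... | inj₂ j∈⁅v⁆ rewrite x∈⁅y⁆⇒x≡y v j∈⁅v⁆ = end∈visited G p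

-- Coordinates in which two vectors differ

differences : ∀ {m k} → Vec (Fin m) k → Vec (Fin m) k → Subset k
differences = Vec.zipWith (λ a b → not (does (a F.≟ b)))

module _ {m k : ℕ} (y z : Vec (Fin m) k) where

  ∈-differences⁻ : ∀ {j} → j ∈ differences y z → lookup y j ≢ lookup z j
  ∈-differences⁻ {j} j∈ y≡z = contradiction false≡true λ ()
    where
    false≡true : false ≡ true
    false≡true = begin
      false                                    ≡⟨ cong not (dec-true (lookup y j F.≟ lookup z j) y≡z) ⟨
      not (does (lookup y j F.≟ lookup z j))   ≡⟨ lookup-zipWith _ j y z ⟨
      lookup (differences y z) j               ≡⟨ []=⇒lookup j∈ ⟩
      true                                     ∎
      where open ≡-Reasoning

  ∈-differences⁺ : ∀ {j} → lookup y j ≢ lookup z j → j ∈ differences y z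
  ∈-differences⁺ {j} y≢z = lookup⇒[]= j _ (trans (lookup-zipWith _ j y z) (cong not (dec-false (lookup y j F.≟ lookup z j) y≢z)))

  ∉-differences⁻ : ∀ {j} → j ∉ differences y z → lookup y j ≡ lookup z j
  ∉-differences⁻ {j} j∉ with lookup y j F.≟ lookup z j
  ... | yes y≡z = y≡z
  ... | no  y≢z = contradiction (∈-differences⁺ y≢z) j∉

AgreeOff : ∀ {A : Set} {k} → Fin k → Vec A k → Vec A k → Set
AgreeOff i y z = ∀ j → j ≢ i → lookup y j ≡ lookup z j

AgreeOff-update : ∀ {A : Set} {k} (y : Vec A k) i b → AgreeOff i y (y [ i ]≔ b)
AgreeOff-update y i b j j≢i = sym (lookup∘update′ j≢i y b)

∈-allVecs : ∀ m k (ys : Vec (Fin m) k) → ys ∈ₗ allVecs m k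
∈-allVecs m zero    []       = here refl
∈-allVecs m (suc k) (y ∷ ys) =
  ∈-concatMap⁺ (λ y → map (y ∷_) (allVecs m k)) (lose (∈-allFin y) (∈-map⁺ (y ∷_) (∈-allVecs m k ys)))

differences-agree : ∀ {m k} {i : Fin k} (z : Vec (Fin m) k) {y y′} → AgreeOff i y y′ → differences z y ⊆ differences z y′ ∪ ⁅ i ⁆
differences-agree {i = i} z {y} {y′} y≈y′ {j} j∈ with j F.≟ i
... | yes refl = x∈p∪q⁺ (inj₂ (x∈⁅x⁆ j))
... | no  j≢i  =
  x∈p∪q⁺ (inj₁ (∈-differences⁺ z y′ (λ zⱼ≡y′ⱼ → ∈-differences⁻ z y j∈ (trans zⱼ≡y′ⱼ (sym (y≈y′ j j≢i))))))

differences-comm : ∀ {m k} (y z : Vec (Fin m) k) → differences y z ≡ differences z y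
differences-comm = zipWith-comm (λ a b → cong not (does-⇔ (mk⇔ sym sym) (a F.≟ b) (b F.≟ a)))

-- Finite sums

module _ {A : Set} where

  sumℕ-cong : ∀ {f g : A → ℕ} xs → (∀ x → f x ≡ g x) → sumℕ f xs ≡ sumℕ g xs
  sumℕ-cong []       f≗g = refl
  sumℕ-cong (x ∷ xs) f≗g = cong₂ _+_ (f≗g x) (sumℕ-cong xs f≗g)

  sumℕ-++ : ∀ (f : A → ℕ) xs ys → sumℕ f (xs ++ ys) ≡ sumℕ f xs + sumℕ f ys
  sumℕ-++ f []       ys = refl
  sumℕ-++ f (x ∷ xs) ys = trans (cong (_+_ (f x)) (sumℕ-++ f xs ys)) (sym (+-assoc (f x) _ _))

  sumℕ-+ : ∀ (f g : A → ℕ) xs → sumℕ (λ a → f a + g a) xs ≡ sumℕ f xs + sumℕ g xs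
  sumℕ-+ f g []       = refl
  sumℕ-+ f g (x ∷ xs) = trans (cong (_+_ (f x + g x)) (sumℕ-+ f g xs)) (regroup (f x) (g x) _ _)
    where
    regroup : ∀ a b c d → a + b + (c + d) ≡ a + c + (b + d)
    regroup = solve-∀

  sumℕ-*ˡ : ∀ c (f : A → ℕ) xs → sumℕ (λ a → c * f a) xs ≡ c * sumℕ f xs
  sumℕ-*ˡ c f []       = sym (*-zeroʳ c)
  sumℕ-*ˡ c f (x ∷ xs) = trans (cong (_+_ (c * f x)) (sumℕ-*ˡ c f xs)) (sym (*-distribˡ-+ c (f x) _))

  sumℕ-const : ∀ c (xs : List A) → sumℕ (λ _ → c) xs ≡ length xs * c
  sumℕ-const c []       = refl
  sumℕ-const c (x ∷ xs) = cong (_+_ c) (sumℕ-const c xs)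

  count-sumℕ : ∀ (p : A → Bool) xs → count p xs ≡ sumℕ (λ x → if p x then 1 else 0) xs
  count-sumℕ p []       = refl
  count-sumℕ p (x ∷ xs) = cong (_+_ (if p x then 1 else 0)) (count-sumℕ p xs)

module _ {A B : Set} where

  sumℕ-map : ∀ (f : B → ℕ) (g : A → B) xs → sumℕ f (map g xs) ≡ sumℕ (f ∘ g) xs
  sumℕ-map f g []       = refl
  sumℕ-map f g (x ∷ xs) = cong (_+_ (f (g x))) (sumℕ-map f g xs)

  sumℕ-concatMap : ∀ (f : B → ℕ) (g : A → List B) xs → sumℕ f (concatMap g xs) ≡ sumℕ (λ a → sumℕ f (g a)) xs
  sumℕ-concatMap f g []       = refl
  sumℕ-concatMap f g (x ∷ xs) = trans (sumℕ-++ f (g x) (concatMap g xs)) (cong (_+_ (sumℕ f (g x))) (sumℕ-concatMap f g xs))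

  sumℕ-comm : ∀ (f : A → B → ℕ) xs ys →
              sumℕ (λ a → sumℕ (f a) ys) xs ≡ sumℕ (λ b → sumℕ (λ a → f a b) xs) ys
  sumℕ-comm f []       ys = sym (trans (sumℕ-const 0 ys) (*-zeroʳ (length ys)))
  sumℕ-comm f (x ∷ xs) ys = trans (cong (_+_ (sumℕ (f x) ys)) (sumℕ-comm f xs ys)) (sym (sumℕ-+ (f x) _ ys))

sumℕ-allFin : ∀ {k} (f : Fin k → ℕ) → sumℕ f (allFin k) ≡ sum f
sumℕ-allFin f = go f id
  where
  go : ∀ {k} {B : Set} (f : B → ℕ) (g : Fin k → B) → sumℕ f (tabulate g) ≡ sum (f ∘ g)
  go {zero}  f g = refl
  go {suc k} f g = cong (_+_ (f (g F.zero))) (go f (g ∘ F.suc))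

sumℕ-allVecs-suc : ∀ m k (h : Vec (Fin m) (suc k) → ℕ) →
                   sumℕ h (allVecs m (suc k)) ≡ sumℕ (λ b → sumℕ (h ∘ (b ∷_)) (allVecs m k)) (allFin m)
sumℕ-allVecs-suc m k h =
  trans (sumℕ-concatMap h (λ b → map (b ∷_) (allVecs m k)) (allFin m))
        (sumℕ-cong (allFin m) (λ b → sumℕ-map h (b ∷_) (allVecs m k)))

length-allVecs : ∀ m k → length (allVecs m k) ≡ m ^ k
length-allVecs m zero    = refl
length-allVecs m (suc k) = begin
  length (allVecs m (suc k))                  ≡⟨ trans (sumℕ-const 1 (allVecs m (suc k))) (*-identityʳ _) ⟨
  sumℕ (λ _ → 1) (allVecs m (suc k))          ≡⟨ sumℕ-allVecs-suc m k (λ _ → 1) ⟩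
  sumℕ (λ _ → sumℕ (λ _ → 1) (allVecs m k)) (allFin m)
    ≡⟨ sumℕ-cong (allFin m) (λ _ → trans (sumℕ-const 1 (allVecs m k)) (trans (*-identityʳ _) (length-allVecs m k))) ⟩
  sumℕ (λ _ → m ^ k) (allFin m)              ≡⟨ sumℕ-const (m ^ k) (allFin m) ⟩
  length (allFin m) * m ^ k                  ≡⟨ cong (_* m ^ k) (length-allFin m) ⟩
  m * m ^ k                                  ∎
  where open ≡-Reasoning

sumℕ-allVecs-lookup : ∀ m k i (P : Fin m → ℕ) →
                      sumℕ (λ z → P (lookup z i)) (allVecs m (suc k)) ≡ m ^ k * sumℕ P (allFin m)
sumℕ-allVecs-lookup m k F.zero P = begin
  sumℕ (λ z → P (lookup z F.zero)) (allVecs m (suc k))     ≡⟨ sumℕ-allVecs-suc m k _ ⟩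
  sumℕ (λ b → sumℕ (λ _ → P b) (allVecs m k)) (allFin m)
    ≡⟨ sumℕ-cong (allFin m) (λ b → trans (sumℕ-const (P b) (allVecs m k)) (cong (_* P b) (length-allVecs m k))) ⟩
  sumℕ (λ b → m ^ k * P b) (allFin m)                       ≡⟨ sumℕ-*ˡ (m ^ k) P (allFin m) ⟩
  m ^ k * sumℕ P (allFin m)                                 ∎
  where open ≡-Reasoning
sumℕ-allVecs-lookup m (suc k) (F.suc i) P = begin
  sumℕ (λ z → P (lookup z (F.suc i))) (allVecs m (suc (suc k)))              ≡⟨ sumℕ-allVecs-suc m (suc k) _ ⟩
  sumℕ (λ _ → sumℕ (λ z → P (lookup z i)) (allVecs m (suc k))) (allFin m)    ≡⟨ sumℕ-const _ (allFin m) ⟩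
  length (allFin m) * sumℕ (λ z → P (lookup z i)) (allVecs m (suc k))         ≡⟨ cong₂ _*_ (length-allFin m) (sumℕ-allVecs-lookup m k i P) ⟩
  m * (m ^ k * sumℕ P (allFin m))                                             ≡⟨ *-assoc m (m ^ k) _ ⟨
  m ^ suc k * sumℕ P (allFin m)                                               ∎
  where open ≡-Reasoning

sumℕ-allSubsets-suc : ∀ k (h : Subset (suc k) → ℕ) →
                      sumℕ h (allSubsets (suc k)) ≡ sumℕ (h ∘ (true ∷_)) (allSubsets k) + sumℕ (h ∘ (false ∷_)) (allSubsets k)
sumℕ-allSubsets-suc k h =
  trans (sumℕ-concatMap h (λ b → map (b ∷_) (allSubsets k)) (true ∷ false ∷ []))
        (cong₂ _+_ (sumℕ-map h (true ∷_) (allSubsets k)) (trans (+-identityʳ _) (sumℕ-map h (false ∷_) (allSubsets k))))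

sumℕ-allFin-≟ : ∀ m′ (a : Fin (suc m′)) (f : Bool → ℕ) →
                sumℕ (λ b → f (not (does (a F.≟ b)))) (allFin (suc m′)) ≡ f false + m′ * f true
sumℕ-allFin-≟ m′ a f = begin
  sumℕ t (allFin (suc m′))          ≡⟨ sumℕ-allFin t ⟩
  sum t                             ≡⟨ sum-remove {i = a} t ⟩
  t a + sum (removeAt t a)          ≡⟨ cong₂ _+_ (cong (f ∘ not) (dec-true (a F.≟ a) refl)) (sum-cong-≗ others) ⟩
  f false + sum {m′} (λ _ → f true) ≡⟨ cong (_+_ (f false)) (sumℕ-allFin {m′} (λ _ → f true)) ⟨
  f false + sumℕ (λ _ → f true) (allFin m′)
    ≡⟨ cong (_+_ (f false)) (trans (sumℕ-const (f true) (allFin m′)) (cong (_* f true) (length-allFin m′))) ⟩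
  f false + m′ * f true             ∎
  where
  open ≡-Reasoning
  t : Fin (suc m′) → ℕ
  t b = f (not (does (a F.≟ b)))
  others : ∀ j → t (punchIn a j) ≡ f true
  others j = cong (f ∘ not) (dec-false (a F.≟ punchIn a j) (punchInᵢ≢i a j ∘ sym))

-- Each coordinate of z either agrees with y (one choice) or differs (m′ choices).
sumℕ-differences : ∀ m′ k (y : Vec (Fin (suc m′)) k) (f : Subset k → ℕ) →
                   sumℕ (λ z → f (differences y z)) (allVecs (suc m′) k) ≡ sumℕ (λ A → m′ ^ ∣ A ∣ * f A) (allSubsets k)
sumℕ-differences m′ zero    []      f = cong (_+ 0) (sym (+-identityʳ (f [])))
sumℕ-differences m′ (suc k) (a ∷ y) f = begin
  sumℕ (λ z → f (differences (a ∷ y) z)) (allVecs (suc m′) (suc k))       ≡⟨ sumℕ-allVecs-suc (suc m′) k _ ⟩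
  sumℕ (λ b → sumℕ (λ z → f (d b ∷ differences y z)) (allVecs (suc m′) k)) (allFin (suc m′))
    ≡⟨ sumℕ-cong (allFin (suc m′)) (λ b → sumℕ-differences m′ k y (f ∘ (d b ∷_))) ⟩
  sumℕ (λ b → g (d b)) (allFin (suc m′))                                   ≡⟨ sumℕ-allFin-≟ m′ a g ⟩
  g false + m′ * g true                                                    ≡⟨ +-comm (g false) _ ⟩
  m′ * g true + g false                                                    ≡⟨ cong (_+ g false) (sumℕ-*ˡ m′ _ (allSubsets k)) ⟨
  sumℕ (λ A → m′ * (m′ ^ ∣ A ∣ * f (true ∷ A))) (allSubsets k) + g false
    ≡⟨ cong (_+ g false) (sumℕ-cong (allSubsets k) (λ A → *-assoc m′ (m′ ^ ∣ A ∣) _)) ⟨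
  sumℕ (λ A → m′ ^ ∣ true ∷ A ∣ * f (true ∷ A)) (allSubsets k) + g false   ≡⟨ sumℕ-allSubsets-suc k _ ⟨
  sumℕ (λ A → m′ ^ ∣ A ∣ * f A) (allSubsets (suc k))                       ∎
  where
  open ≡-Reasoning
  d : Fin (suc m′) → Bool
  d b = not (does (a F.≟ b))
  g : Bool → ℕ
  g c = sumℕ (λ A → m′ ^ ∣ A ∣ * f (c ∷ A)) (allSubsets k)

sum-agree-off : ∀ {k} (f g : Fin (suc k) → ℕ) i → (∀ j → j ≢ i → f j ≡ g j) → sum f + g i ≡ sum g + f i
sum-agree-off f g i f≈g = begin
  sum f + g i                    ≡⟨ cong (_+ g i) (sum-remove {i = i} f) ⟩
  f i + sum (removeAt f i) + g i ≡⟨ cong (λ r → f i + r + g i) (sum-cong-≗ (λ j → f≈g (punchIn i j) (punchInᵢ≢i i j))) ⟩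
  f i + sum (removeAt g i) + g i ≡⟨ swap (f i) (sum (removeAt g i)) (g i) ⟩
  g i + sum (removeAt g i) + f i ≡⟨ cong (_+ f i) (sum-remove {i = i} g) ⟨
  sum g + f i                    ∎
  where
  open ≡-Reasoning
  swap : ∀ a r b → a + r + b ≡ b + r + a
  swap = solve-∀

sum-mono-≤ : ∀ {k} {f g : Fin k → ℕ} → (∀ j → f j ≤ g j) → sum f ≤ sum g
sum-mono-≤ {zero}  _   = z≤n
sum-mono-≤ {suc k} f≤g = +-mono-≤ (f≤g F.zero) (sum-mono-≤ (f≤g ∘ F.suc))

-- Rational weights

ℕtoℚ-toℚᵘ : ∀ a → toℚᵘ (ℕtoℚ a) ℚᵘ.≃ mkℚᵘ (+ a) 0
ℕtoℚ-toℚᵘ a = ℚ.toℚᵘ-fromℚᵘ (mkℚᵘ (+ a) 0)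

ℕtoℚ-+ : ∀ a b → ℕtoℚ (a + b) ≡ ℕtoℚ a ℚ.+ ℕtoℚ b
ℕtoℚ-+ a b = ℚ.toℚᵘ-injective (begin
  toℚᵘ (ℕtoℚ (a + b))                 ≈⟨ ℕtoℚ-toℚᵘ (a + b) ⟩
  mkℚᵘ (+ (a + b)) 0                  ≈⟨ *≡* cross ⟩
  mkℚᵘ (+ a) 0 ℚᵘ.+ mkℚᵘ (+ b) 0      ≈⟨ ℚᵘ.+-cong (ℕtoℚ-toℚᵘ a) (ℕtoℚ-toℚᵘ b) ⟨
  toℚᵘ (ℕtoℚ a) ℚᵘ.+ toℚᵘ (ℕtoℚ b)    ≈⟨ ℚ.toℚᵘ-homo-+ (ℕtoℚ a) (ℕtoℚ b) ⟨
  toℚᵘ (ℕtoℚ a ℚ.+ ℕtoℚ b)            ∎)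
  where
  open ℚᵘ.≃-Reasoning
  cross : + (a + b) ℤ.* + 1 ≡ (+ a ℤ.* + 1 ℤ.+ + b ℤ.* + 1) ℤ.* + 1
  cross rewrite ℤ.*-identityʳ (+ (a + b)) | ℤ.*-identityʳ (+ a) | ℤ.*-identityʳ (+ b)
              | ℤ.*-identityʳ (+ a ℤ.+ + b) = ℤ.pos-+ a b

ℕtoℚ-* : ∀ a b → ℕtoℚ (a * b) ≡ ℕtoℚ a ℚ.* ℕtoℚ b
ℕtoℚ-* a b = ℚ.toℚᵘ-injective (begin
  toℚᵘ (ℕtoℚ (a * b))                 ≈⟨ ℕtoℚ-toℚᵘ (a * b) ⟩
  mkℚᵘ (+ (a * b)) 0                  ≈⟨ *≡* cross ⟩
  mkℚᵘ (+ a) 0 ℚᵘ.* mkℚᵘ (+ b) 0      ≈⟨ ℚᵘ.*-cong (ℕtoℚ-toℚᵘ a) (ℕtoℚ-toℚᵘ b) ⟨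
  toℚᵘ (ℕtoℚ a) ℚᵘ.* toℚᵘ (ℕtoℚ b)    ≈⟨ ℚ.toℚᵘ-homo-* (ℕtoℚ a) (ℕtoℚ b) ⟨
  toℚᵘ (ℕtoℚ a ℚ.* ℕtoℚ b)            ∎)
  where
  open ℚᵘ.≃-Reasoning
  cross : + (a * b) ℤ.* + 1 ≡ (+ a ℤ.* + b) ℤ.* + 1
  cross rewrite ℤ.*-identityʳ (+ (a * b)) | ℤ.*-identityʳ (+ a ℤ.* + b) = ℤ.pos-* a b

ℕtoℚ-≤⇔ : ∀ {a b} → ℕtoℚ a ℚ.≤ ℕtoℚ b ⇔ a ≤ b
ℕtoℚ-≤⇔ {a} {b} = mk⇔ cancel mono
  where
  unfold : ∀ a → + a ℤ.* + 1 ≡ + a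
  unfold a = ℤ.*-identityʳ (+ a)
  cancel : ℕtoℚ a ℚ.≤ ℕtoℚ b → a ≤ b
  cancel le with ℚᵘ.≤-respˡ-≃ (ℕtoℚ-toℚᵘ a) (ℚᵘ.≤-respʳ-≃ (ℕtoℚ-toℚᵘ b) (ℚ.toℚᵘ-mono-≤ le))
  ... | *≤* le′ = ℤ.drop‿+≤+ (subst₂ ℤ._≤_ (unfold a) (unfold b) le′)
  mono : a ≤ b → ℕtoℚ a ℚ.≤ ℕtoℚ b
  mono a≤b = ℚ.toℚᵘ-cancel-≤ (ℚᵘ.≤-respˡ-≃ (ℚᵘ.≃-sym (ℕtoℚ-toℚᵘ a))
    (ℚᵘ.≤-respʳ-≃ (ℚᵘ.≃-sym (ℕtoℚ-toℚᵘ b)) (*≤* (subst₂ ℤ._≤_ (sym (unfold a)) (sym (unfold b)) (ℤ.+≤+ a≤b)))))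

scaled-≤⇔ : ∀ c .{{_ : Positive c}} {a b} → c ℚ.* ℕtoℚ a ℚ.≤ c ℚ.* ℕtoℚ b ⇔ a ≤ b
scaled-≤⇔ c = mk⇔ (λ le → Equivalence.to ℕtoℚ-≤⇔ (ℚ.*-cancelˡ-≤-pos c le))
                  (λ le → ℚ.*-monoˡ-≤-nonNeg c {{ℚ.pos⇒nonNeg c}} (Equivalence.from ℕtoℚ-≤⇔ le))

scaled-injective : ∀ c .{{_ : Positive c}} {a b} → c ℚ.* ℕtoℚ a ≡ c ℚ.* ℕtoℚ b → a ≡ b
scaled-injective c e =
  ≤-antisym (Equivalence.to (scaled-≤⇔ c) (ℚ.≤-reflexive e)) (Equivalence.to (scaled-≤⇔ c) (ℚ.≤-reflexive (sym e)))

module _ {A : Set} where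

  sumℚ-cong : ∀ {f g : A → ℚ} xs → (∀ x → f x ≡ g x) → sumℚ f xs ≡ sumℚ g xs
  sumℚ-cong []       f≗g = refl
  sumℚ-cong (x ∷ xs) f≗g = cong₂ ℚ._+_ (f≗g x) (sumℚ-cong xs f≗g)

  sumℚ-scaled : ∀ c (f : A → ℕ) xs → sumℚ (λ x → c ℚ.* ℕtoℚ (f x)) xs ≡ c ℚ.* ℕtoℚ (sumℕ f xs)
  sumℚ-scaled c f []       = sym (ℚ.*-zeroʳ c)
  sumℚ-scaled c f (x ∷ xs) = begin
    c ℚ.* ℕtoℚ (f x) ℚ.+ sumℚ (λ x → c ℚ.* ℕtoℚ (f x)) xs ≡⟨ cong (ℚ._+_ (c ℚ.* ℕtoℚ (f x))) (sumℚ-scaled c f xs) ⟩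
    c ℚ.* ℕtoℚ (f x) ℚ.+ c ℚ.* ℕtoℚ (sumℕ f xs)          ≡⟨ ℚ.*-distribˡ-+ c (ℕtoℚ (f x)) _ ⟨
    c ℚ.* (ℕtoℚ (f x) ℚ.+ ℕtoℚ (sumℕ f xs))              ≡⟨ cong (c ℚ.*_) (ℕtoℚ-+ (f x) (sumℕ f xs)) ⟨
    c ℚ.* ℕtoℚ (f x + sumℕ f xs)                         ∎
    where open ≡-Reasoning

powℚ-* : ∀ x y k → powℚ (x ℚ.* y) k ≡ powℚ x k ℚ.* powℚ y k
powℚ-* x y zero    = sym (ℚ.*-identityˡ 1ℚ)
powℚ-* x y (suc k) = trans (cong ((x ℚ.* y) ℚ.*_) (powℚ-* x y k)) (interchange x y (powℚ x k) (powℚ y k))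

powℚ-+ : ∀ x a b → powℚ x a ℚ.* powℚ x b ≡ powℚ x (a + b)
powℚ-+ x zero    b = ℚ.*-identityˡ (powℚ x b)
powℚ-+ x (suc a) b = trans (ℚ.*-assoc x (powℚ x a) (powℚ x b)) (cong (x ℚ.*_) (powℚ-+ x a b))

powℚ-ℕtoℚ : ∀ a k → powℚ (ℕtoℚ a) k ≡ ℕtoℚ (a ^ k)
powℚ-ℕtoℚ a zero    = refl
powℚ-ℕtoℚ a (suc k) = trans (cong (ℕtoℚ a ℚ.*_) (powℚ-ℕtoℚ a k)) (sym (ℕtoℚ-* a (a ^ k)))

powℚ-pos : ∀ x .{{_ : Positive x}} k → Positive (powℚ x k)
powℚ-pos x zero    = _
powℚ-pos x (suc k) = ℚ.pos*pos⇒pos x (powℚ x k) {{powℚ-pos x k}}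

module _ (m′ : ℕ) where

  1-m′/[1+m′] : 1ℚ ℚ.- + m′ / suc m′ ≡ + 1 / suc m′
  1-m′/[1+m′] = ℚ.toℚᵘ-injective (begin
    toℚᵘ (1ℚ ℚ.- p)                          ≈⟨ ℚ.toℚᵘ-homo-+ 1ℚ (ℚ.- p) ⟩
    toℚᵘ 1ℚ ℚᵘ.+ toℚᵘ (ℚ.- p)
      ≈⟨ ℚᵘ.+-cong (ℚ.toℚᵘ-fromℚᵘ (mkℚᵘ (+ 1) 0))
                   (ℚᵘ.≃-trans (ℚ.toℚᵘ-homo‿- p) (ℚᵘ.-‿cong (ℚ.toℚᵘ-fromℚᵘ (mkℚᵘ (+ m′) m′)))) ⟩
    mkℚᵘ (+ 1) 0 ℚᵘ.+ ℚᵘ.- mkℚᵘ (+ m′) m′    ≈⟨ *≡* cross ⟩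
    mkℚᵘ (+ 1) m′                           ≈⟨ ℚ.toℚᵘ-fromℚᵘ (mkℚᵘ (+ 1) m′) ⟨
    toℚᵘ (+ 1 / suc m′)                      ∎)
    where
    open ℚᵘ.≃-Reasoning
    p : ℚ
    p = + m′ / suc m′
    numerator : ∀ x → + 1 ℤ.* (+ 1 ℤ.+ x) ℤ.+ (ℤ.- x) ℤ.* + 1 ≡ + 1
    numerator = ℤ.solve-∀
    cross : (+ 1 ℤ.* (+ 1 ℤ.+ + m′) ℤ.+ (ℤ.- + m′) ℤ.* + 1) ℤ.* + suc m′ ≡ + 1 ℤ.* + suc (m′ + 0)
    cross = trans (cong (ℤ._* + suc m′) (numerator (+ m′))) (cong (λ d → + 1 ℤ.* + suc d) (sym (+-identityʳ m′)))

  m′/[1+m′] : + m′ / suc m′ ≡ ℕtoℚ m′ ℚ.* (+ 1 / suc m′)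
  m′/[1+m′] = ℚ.toℚᵘ-injective (begin
    toℚᵘ (+ m′ / suc m′)                       ≈⟨ ℚ.toℚᵘ-fromℚᵘ (mkℚᵘ (+ m′) m′) ⟩
    mkℚᵘ (+ m′) m′                            ≈⟨ *≡* cross ⟩
    mkℚᵘ (+ m′) 0 ℚᵘ.* mkℚᵘ (+ 1) m′
      ≈⟨ ℚᵘ.*-cong (ℕtoℚ-toℚᵘ m′) (ℚ.toℚᵘ-fromℚᵘ (mkℚᵘ (+ 1) m′)) ⟨
    toℚᵘ (ℕtoℚ m′) ℚᵘ.* toℚᵘ (+ 1 / suc m′)     ≈⟨ ℚ.toℚᵘ-homo-* (ℕtoℚ m′) (+ 1 / suc m′) ⟨
    toℚᵘ (ℕtoℚ m′ ℚ.* (+ 1 / suc m′))          ∎)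
    where
    open ℚᵘ.≃-Reasoning
    cross : + m′ ℤ.* + suc (m′ + 0) ≡ (+ m′ ℤ.* + 1) ℤ.* + suc m′
    cross = trans (cong (λ d → + m′ ℤ.* + suc d) (+-identityʳ m′)) (cong (ℤ._* + suc m′) (sym (ℤ.*-identityʳ (+ m′))))

  pA-uniform : ∀ {n} (G : SimpleGraph n) A → pA G (+ m′ / suc m′) A ≡ powℚ (+ 1 / suc m′) n ℚ.* ℕtoℚ (m′ ^ ∣ A ∣)
  pA-uniform {n} G A
    rewrite 1-m′/[1+m′] | m′/[1+m′] | powℚ-* (ℕtoℚ m′) (+ 1 / suc m′) ∣ A ∣ | powℚ-ℕtoℚ m′ ∣ A ∣ = begin
    ℕtoℚ (m′ ^ ∣ A ∣) ℚ.* powℚ q ∣ A ∣ ℚ.* powℚ q (n ∸ ∣ A ∣)     ≡⟨ ℚ.*-assoc (ℕtoℚ (m′ ^ ∣ A ∣)) _ _ ⟩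
    ℕtoℚ (m′ ^ ∣ A ∣) ℚ.* (powℚ q ∣ A ∣ ℚ.* powℚ q (n ∸ ∣ A ∣))
      ≡⟨ cong (ℕtoℚ (m′ ^ ∣ A ∣) ℚ.*_) (trans (powℚ-+ q ∣ A ∣ _) (cong (powℚ q) (m+[n∸m]≡n (∣p∣≤n A)))) ⟩
    ℕtoℚ (m′ ^ ∣ A ∣) ℚ.* powℚ q n                                ≡⟨ ℚ.*-comm _ (powℚ q n) ⟩
    powℚ q n ℚ.* ℕtoℚ (m′ ^ ∣ A ∣)                                ∎
    where
    open ≡-Reasoning
    q : ℚ
    q = + 1 / suc m′

-- Medians

inv-pos : ∀ {A : Set} {x : A} {xs} → x ∈ₗ xs → Positive (inv (length xs))
inv-pos {xs = _ ∷ xs} _ = ℚ.normalize-pos 1 (suc (length xs))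

totalDist : (K : FinGraph) → V K → ℕ
totalDist K u = sumℕ (dist K u) (verts K)

IsMedian⇔ : ∀ (K : FinGraph) {v₀} → v₀ ∈ₗ verts K → ∀ u → IsMedian K u ⇔ (∀ v → totalDist K u ≤ totalDist K v)
IsMedian⇔ K v₀∈ u = mk⇔ (λ med v → Equivalence.to (scaled-≤⇔ c) (med v)) (λ min v → Equivalence.from (scaled-≤⇔ c) (min v))
  where
  c : ℚ
  c = inv (length (verts K))
  instance
    c-pos : Positive c
    c-pos = inv-pos v₀∈

separable-minimum : ∀ {X B : Set} {k} (T : X → ℕ) (S : B → ℕ) K .{{_ : NonZero K}} (y : Vec B (suc k)) x →
  (∀ y′ x′ → T x + K * sum (S ∘ lookup y) ≤ T x′ + K * sum (S ∘ lookup y′))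
    ⇔ ((∀ j b → S (lookup y j) ≤ S b) × (∀ x′ → T x ≤ T x′))
separable-minimum {X} {B} {k} T S K y x = mk⇔ split combine
  where
  ΣS : Vec B (suc k) → ℕ
  ΣS y = sum (S ∘ lookup y)
  Minimal : Set
  Minimal = ∀ y′ x′ → T x + K * ΣS y ≤ T x′ + K * ΣS y′
  combine : (∀ j b → S (lookup y j) ≤ S b) × (∀ x′ → T x ≤ T x′) → Minimal
  combine (S-min , T-min) y′ x′ = +-mono-≤ (T-min x′) (*-monoʳ-≤ K (sum-mono-≤ (λ j → S-min j (lookup y′ j))))
  split : Minimal → (∀ j b → S (lookup y j) ≤ S b) × (∀ x′ → T x ≤ T x′)
  split min = S-min , λ x′ → +-cancelʳ-≤ (K * ΣS y) (T x) (T x′) (min y x′)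
    where
    S-min : ∀ j b → S (lookup y j) ≤ S b
    S-min j b = +-cancelˡ-≤ (ΣS y′) _ _ (begin
      ΣS y′ + S (lookup y j)
        ≡⟨ sum-agree-off (S ∘ lookup y) (S ∘ lookup y′) j (λ i i≢j → cong S (AgreeOff-update y j b i i≢j)) ⟨
      ΣS y + S (lookup y′ j)   ≤⟨ +-monoˡ-≤ _ (*-cancelˡ-≤ K (+-cancelˡ-≤ (T x) _ _ (min y′ x))) ⟩
      ΣS y′ + S (lookup y′ j)  ≡⟨ cong (λ c → ΣS y′ + S c) (lookup∘update j y b) ⟩
      ΣS y′ + S b              ∎)
      where
      open ≤-Reasoning
      y′ : Vec B (suc k)
      y′ = y [ j ]≔ b

-- Travelling-salesman sums for p = m′/(m′+1)

module TravellingSalesman {n′ : ℕ} (G : SimpleGraph (suc n′)) (m′ : ℕ) where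

  private
    n : ℕ
    n = suc n′
    p : ℚ
    p = + m′ / suc m′
    κ : ℚ
    κ = powℚ (+ 1 / suc m′) n

  tourSum : Fin n → ℕ
  tourSum x = sumℕ (λ A → m′ ^ ∣ A ∣ * sumℕ (ρ G A x) (allFin n)) (allSubsets n)

  winSum : Fin n → Fin n → ℕ
  winSum i k = sumℕ (λ A → m′ ^ ∣ A ∣ * count (λ z → ρ G A z i <ᵇ ρ G A z k) (allFin n)) (allSubsets n)

  weighted-sum : ∀ (f : Subset n → ℕ) →
                 sumℚ (λ A → pA G p A ℚ.* ℕtoℚ (f A)) (allSubsets n) ≡ κ ℚ.* ℕtoℚ (sumℕ (λ A → m′ ^ ∣ A ∣ * f A) (allSubsets n))
  weighted-sum f = trans (sumℚ-cong (allSubsets n) term) (sumℚ-scaled κ (λ A → m′ ^ ∣ A ∣ * f A) (allSubsets n))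
    where
    term : ∀ A → pA G p A ℚ.* ℕtoℚ (f A) ≡ κ ℚ.* ℕtoℚ (m′ ^ ∣ A ∣ * f A)
    term A = begin
      pA G p A ℚ.* ℕtoℚ (f A)                    ≡⟨ cong (ℚ._* ℕtoℚ (f A)) (pA-uniform m′ G A) ⟩
      κ ℚ.* ℕtoℚ (m′ ^ ∣ A ∣) ℚ.* ℕtoℚ (f A)     ≡⟨ ℚ.*-assoc κ _ _ ⟩
      κ ℚ.* (ℕtoℚ (m′ ^ ∣ A ∣) ℚ.* ℕtoℚ (f A))   ≡⟨ cong (κ ℚ.*_) (ℕtoℚ-* (m′ ^ ∣ A ∣) (f A)) ⟨
      κ ℚ.* ℕtoℚ (m′ ^ ∣ A ∣ * f A)              ∎
      where open ≡-Reasoning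

  tsDist-≡ : ∀ x → tsDist G p x ≡ (inv n ℚ.* κ) ℚ.* ℕtoℚ (tourSum x)
  tsDist-≡ x = begin
    tsDist G p x
      ≡⟨ cong (inv n ℚ.*_) (sumℚ-cong (allFin n) (λ v → weighted-sum (λ A → ρ G A x v))) ⟩
    inv n ℚ.* sumℚ (λ v → κ ℚ.* ℕtoℚ (sumℕ (λ A → m′ ^ ∣ A ∣ * ρ G A x v) (allSubsets n))) (allFin n)
      ≡⟨ cong (inv n ℚ.*_) (sumℚ-scaled κ (λ v → sumℕ (λ A → m′ ^ ∣ A ∣ * ρ G A x v) (allSubsets n)) (allFin n)) ⟩
    inv n ℚ.* (κ ℚ.* ℕtoℚ (sumℕ (λ v → sumℕ (λ A → m′ ^ ∣ A ∣ * ρ G A x v) (allSubsets n)) (allFin n)))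
      ≡⟨ cong (λ t → inv n ℚ.* (κ ℚ.* ℕtoℚ t)) swap ⟩
    inv n ℚ.* (κ ℚ.* ℕtoℚ (tourSum x))
      ≡⟨ ℚ.*-assoc (inv n) κ _ ⟨
    (inv n ℚ.* κ) ℚ.* ℕtoℚ (tourSum x) ∎
    where
    open ≡-Reasoning
    swap : sumℕ (λ v → sumℕ (λ A → m′ ^ ∣ A ∣ * ρ G A x v) (allSubsets n)) (allFin n) ≡ tourSum x
    swap = trans (sumℕ-comm (λ v A → m′ ^ ∣ A ∣ * ρ G A x v) (allFin n) (allSubsets n))
                 (sumℕ-cong (allSubsets n) (λ A → sumℕ-*ˡ (m′ ^ ∣ A ∣) (ρ G A x) (allFin n)))

  wp-≡ : ∀ i k → wp G p i k ≡ κ ℚ.* ℕtoℚ (winSum i k)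
  wp-≡ i k = weighted-sum (λ A → count (λ z → ρ G A z i <ᵇ ρ G A z k) (allFin n))

  private
    instance
      κ-pos : Positive κ
      κ-pos = powℚ-pos (+ 1 / suc m′) {{ℚ.normalize-pos 1 (suc m′)}} n
      c-pos : Positive (inv n ℚ.* κ)
      c-pos = ℚ.pos*pos⇒pos (inv n) {{ℚ.normalize-pos 1 n}} κ

  IsPTSMedian⇔ : ∀ x → IsPTSMedian G p x ⇔ (∀ v → tourSum x ≤ tourSum v)
  IsPTSMedian⇔ x = mk⇔
    (λ med v → Equivalence.to (scaled-≤⇔ (inv n ℚ.* κ)) (subst₂ ℚ._≤_ (tsDist-≡ x) (tsDist-≡ v) (med v)))
    (λ min v → subst₂ ℚ._≤_ (sym (tsDist-≡ x)) (sym (tsDist-≡ v)) (Equivalence.from (scaled-≤⇔ (inv n ℚ.* κ)) (min v)))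

  PTSDistanceBalanced⇔ : PTSDistanceBalanced G p ⇔ (∀ i k → adj G i k ≡ true → winSum i k ≡ winSum k i)
  PTSDistanceBalanced⇔ = mk⇔
    (λ bal i k e → scaled-injective κ (trans (sym (wp-≡ i k)) (trans (bal i k e) (wp-≡ k i))))
    (λ bal i k e → trans (wp-≡ i k) (trans (cong (λ w → κ ℚ.* ℕtoℚ w) (bal i k e)) (sym (wp-≡ k i))))

-- The wreath product

module Wreath {n′ m′ : ℕ} (G : SimpleGraph (suc n′)) (H : SimpleGraph (suc m′))
              (connected-G : Connected (toFG G)) (connected-H : Connected (toFG H)) where

  open TravellingSalesman G m′

  private
    n m : ℕ
    n = suc n′
    m = suc m′
    W : FinGraph
    W = G ≀ H
    dH : Fin m → Fin m → ℕ
    dH = dist (toFG H)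
    K : ℕ
    K = n * m ^ n′
    indicator : Bool → ℕ
    indicator c = if c then 1 else 0

  ∈-verts-≀ : ∀ v → v ∈ₗ verts W
  ∈-verts-≀ (ys , x) =
    ∈-concatMap⁺ (λ ys → map (ys ,_) (allFin n)) (lose (∈-allVecs m n ys) (∈-map⁺ (ys ,_) (∈-allFin x)))

  -- Defs' agreeOff is private; this copy unfolds to the same term.
  private
    agrees : Fin n → Vec (Fin m) n → Vec (Fin m) n → Fin n → Bool
    agrees i y z j = does (j F.≟ i) ∨ does (lookup y j F.≟ lookup z j)
    agreeOffᵇ : Fin n → Vec (Fin m) n → Vec (Fin m) n → Bool
    agreeOffᵇ i y z = all (agrees i y z) (allFin n)

  adj-base : ∀ y {i k} → adj G i k ≡ true → Adj W (y , i) (y , k) ≡ true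
  adj-base y e rewrite dec-true (VecP.≡-dec F._≟_ y y) refl | e = ∨-zeroʳ _

  adj-fibre : ∀ y i {b} → adj H (lookup y i) b ≡ true → Adj W (y , i) (y [ i ]≔ b , i) ≡ true
  adj-fibre y i {b} e =
    ∨-trueˡ (does (VecP.≡-dec F._≟_ y (y [ i ]≔ b)) ∧ adj G i i)
      (cong₂ _∧_ (dec-true (i F.≟ i) refl)
        (cong₂ _∧_ (all-true⁺ (agrees i y (y [ i ]≔ b)) (allFin n) agree)
                   (trans (cong (adj H (lookup y i)) (lookup∘update i y b)) e)))
    where
    agree : ∀ {j} → j ∈ₗ allFin n → agrees i y (y [ i ]≔ b) j ≡ true
    agree {j} _ with j F.≟ i
    ... | yes _   = refl
    ... | no  j≢i = dec-true (lookup y j F.≟ _) (AgreeOff-update y i b j j≢i)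

  adj⁻ : ∀ y i z k → Adj W (y , i) (z , k) ≡ true →
         (i ≡ k × AgreeOff i y z × adj H (lookup y i) (lookup z i) ≡ true) ⊎ (y ≡ z × adj G i k ≡ true)
  adj⁻ y i z k e with ∨-true⁻ (does (i F.≟ k) ∧ agreeOffᵇ i y z ∧ adj H (lookup y i) (lookup z i)) e
  ... | inj₂ e₂ =
    inj₂ (does-true⁻ (VecP.≡-dec F._≟_ y z) (∧-conicalˡ _ (adj G i k) e₂) , ∧-conicalʳ (does (VecP.≡-dec F._≟_ y z)) _ e₂)
  ... | inj₁ e₁ = inj₁ (does-true⁻ (i F.≟ k) (∧-conicalˡ _ _ e₁) , agree , ∧-conicalʳ (agreeOffᵇ i y z) _ rest)
    where
    rest : agreeOffᵇ i y z ∧ adj H (lookup y i) (lookup z i) ≡ true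
    rest = ∧-conicalʳ (does (i F.≟ k)) _ e₁
    agree : AgreeOff i y z
    agree j j≢i with ∨-true⁻ (does (j F.≟ i))
                      (all-true⁻ (agrees i y z) (allFin n)
                        (∧-conicalˡ _ (adj H (lookup y i) (lookup z i)) rest) (∈-allFin j))
    ... | inj₁ j≡i   = contradiction (does-true⁻ (j F.≟ i) j≡i) j≢i
    ... | inj₂ yⱼ≡zⱼ = does-true⁻ (lookup y j F.≟ lookup z j) yⱼ≡zⱼ

  lift-fibre : ∀ {k a b} → LWalk (toFG H) k a b → ∀ y i → lookup y i ≡ a → LWalk W k (y , i) (y [ i ]≔ b , i)
  lift-fibre nil y i refl rewrite []≔-lookup y i = nil
  lift-fibre (cons {w = w} e p) y i refl =
    cons (adj-fibre y i e)
      (subst (λ y′ → LWalk W _ (y [ i ]≔ w , i) (y′ , i)) ([]≔-idempotent y i)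
        (lift-fibre p (y [ i ]≔ w) i (lookup∘update i y w)))

  dH-refl : ∀ a → dH a a ≡ 0
  dH-refl a = n≤0⇒n≡0 (dist-minimal (toFG H) ∈-allFin nil)

  dH-walk : ∀ a b → LWalk (toFG H) (dH a b) a b
  dH-walk a b = dist-attained (toFG H) ∈-allFin (proj₂ (toLWalk (connected-H a b)))

  coordDist : Vec (Fin m) n → Vec (Fin m) n → ℕ
  coordDist y z = sum (λ j → dH (lookup y j) (lookup z j))

  coordDist-self : ∀ y → coordDist y y ≡ 0
  coordDist-self y = trans (sum-cong-≗ (λ j → dH-refl (lookup y j))) (sum-replicate-zero n)

  coordDist-agree : ∀ {i} y y′ z → AgreeOff i y y′ →
                    coordDist y z + dH (lookup y′ i) (lookup z i) ≡ coordDist y′ z + dH (lookup y i) (lookup z i)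
  coordDist-agree {i} y y′ z y≈y′ = sum-agree-off _ _ i (λ j j≢i → cong (λ a → dH a (lookup z j)) (y≈y′ j j≢i))

  coordDist-fix : ∀ y z i → coordDist y z ≡ coordDist (y [ i ]≔ lookup z i) z + dH (lookup y i) (lookup z i)
  coordDist-fix y z i = begin
    coordDist y z                                     ≡⟨ +-identityʳ _ ⟨
    coordDist y z + 0                                 ≡⟨ cong (_+_ (coordDist y z)) (dH-refl (lookup z i)) ⟨
    coordDist y z + dH (lookup z i) (lookup z i)      ≡⟨ cong (λ a → coordDist y z + dH a (lookup z i)) (lookup∘update i y (lookup z i)) ⟨
    coordDist y z + dH (lookup y′ i) (lookup z i)     ≡⟨ coordDist-agree y y′ z (AgreeOff-update y i (lookup z i)) ⟩
    coordDist y′ z + dH (lookup y i) (lookup z i)     ∎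
    where
    open ≡-Reasoning
    y′ : Vec (Fin m) n
    y′ = y [ i ]≔ lookup z i

  coordDist-step : ∀ {i} y y′ z → AgreeOff i y y′ → adj H (lookup y i) (lookup y′ i) ≡ true →
                   coordDist y z ≤ suc (coordDist y′ z)
  coordDist-step {i} y y′ z y≈y′ e = +-cancelʳ-≤ (dH (lookup y′ i) (lookup z i)) (coordDist y z) (suc (coordDist y′ z)) (begin
    coordDist y z + dH (lookup y′ i) (lookup z i)        ≡⟨ coordDist-agree y y′ z y≈y′ ⟩
    coordDist y′ z + dH (lookup y i) (lookup z i)        ≤⟨ +-monoʳ-≤ (coordDist y′ z) triangle ⟩
    coordDist y′ z + suc (dH (lookup y′ i) (lookup z i)) ≡⟨ +-suc (coordDist y′ z) _ ⟩
    suc (coordDist y′ z + dH (lookup y′ i) (lookup z i)) ∎)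
    where
    open ≤-Reasoning
    triangle : dH (lookup y i) (lookup z i) ≤ suc (dH (lookup y′ i) (lookup z i))
    triangle = dist-minimal (toFG H) ∈-allFin (cons e (dH-walk (lookup y′ i) (lookup z i)))

  project : ∀ {k y x z x′} → LWalk W k (y , x) (z , x′) →
            ∃ λ g → g + coordDist y z ≤ k × Σ (LWalk (toFG G) g x x′) λ q → differences y z ⊆ visited G q
  project {y = y} nil = 0 , ≤-reflexive (coordDist-self y) , nil , λ j∈ → contradiction refl (∈-differences⁻ y y j∈)
  project {suc k} {y} {x} {z} (cons {w = y′ , x₂} e p) with project p | adj⁻ y x y′ x₂ e
  ... | g , g+d≤k , q , D⊆q | inj₂ (refl , e-G) =
    suc g , s≤s g+d≤k , cons e-G q , λ j∈ → x∈p∪q⁺ (inj₂ (D⊆q j∈))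
  ... | g , g+d≤k , q , D⊆q | inj₁ (refl , y≈y′ , e-H) = g , g+d≤suc-k , q , D⊆q′
    where
    g+d≤suc-k : g + coordDist y z ≤ suc k
    g+d≤suc-k = begin
      g + coordDist y z         ≤⟨ +-monoʳ-≤ g (coordDist-step y y′ z y≈y′ e-H) ⟩
      g + suc (coordDist y′ z)  ≡⟨ +-suc g _ ⟩
      suc (g + coordDist y′ z)  ≤⟨ s≤s g+d≤k ⟩
      suc k                     ∎
      where open ≤-Reasoning
    D⊆q′ : differences y z ⊆ visited G q
    D⊆q′ {j} j∈ with j F.≟ x
    ... | yes refl = start∈visited G q
    ... | no  j≢x  = D⊆q (∈-differences⁺ y′ z (λ y′≡z → ∈-differences⁻ y z j∈ (trans (y≈y′ j j≢x) y′≡z)))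

  lift : ∀ {g x x′} (q : LWalk (toFG G) g x x′) y z → differences y z ⊆ visited G q →
         LWalk W (g + coordDist y z) (y , x) (z , x′)
  lift {x = x} nil y z D⊆x =
    subst₂ (λ d z′ → LWalk W d (y , x) (z′ , x)) (sym single-coordinate) fixed
      (lift-fibre (dH-walk (lookup y x) (lookup z x)) y x refl)
    where
    fixed : y [ x ]≔ lookup z x ≡ z
    fixed = trans (sym (tabulate∘lookup _)) (trans (tabulate-cong pointwise) (tabulate∘lookup z))
      where
      pointwise : ∀ j → lookup (y [ x ]≔ lookup z x) j ≡ lookup z j
      pointwise j with j F.≟ x
      ... | yes refl = lookup∘update j y (lookup z j)
      ... | no  j≢x  = trans (sym (AgreeOff-update y x _ j j≢x))
                             (∉-differences⁻ y z (λ j∈ → j≢x (x∈⁅y⁆⇒x≡y x (D⊆x j∈))))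
    single-coordinate : coordDist y z ≡ dH (lookup y x) (lookup z x)
    single-coordinate = begin
      coordDist y z                                             ≡⟨ coordDist-fix y z x ⟩
      coordDist (y [ x ]≔ lookup z x) z + dH (lookup y x) (lookup z x)
        ≡⟨ cong (λ z′ → coordDist z′ z + dH (lookup y x) (lookup z x)) fixed ⟩
      coordDist z z + dH (lookup y x) (lookup z x)              ≡⟨ cong (_+ dH (lookup y x) (lookup z x)) (coordDist-self z) ⟩
      dH (lookup y x) (lookup z x)                              ∎
      where open ≡-Reasoning
  lift {suc g} {x} {x′} (cons {w = w} e q) y z D⊆ =
    subst (λ d → LWalk W d (y , x) (z , x′)) length-≡
      (lift-fibre (dH-walk (lookup y x) (lookup z x)) y x refl ++ʷ cons (adj-base y′ e) (lift q y′ z D′⊆q))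
    where
    y′ : Vec (Fin m) n
    y′ = y [ x ]≔ lookup z x
    D′⊆q : differences y′ z ⊆ visited G q
    D′⊆q {j} j∈ with j F.≟ x
    ... | yes refl = contradiction (lookup∘update j y (lookup z j)) (∈-differences⁻ y′ z j∈)
    ... | no  j≢x with x∈p∪q⁻ ⁅ x ⁆ (visited G q)
                         (D⊆ (∈-differences⁺ y z (λ y≡z → ∈-differences⁻ y′ z j∈ (trans (sym (AgreeOff-update y x _ j j≢x)) y≡z))))
    ...   | inj₁ j∈⁅x⁆ = contradiction (x∈⁅y⁆⇒x≡y x j∈⁅x⁆) j≢x
    ...   | inj₂ j∈q   = j∈q
    length-≡ : dH (lookup y x) (lookup z x) + suc (g + coordDist y′ z) ≡ suc g + coordDist y z
    length-≡ = trans (rearrange (dH (lookup y x) (lookup z x)) g (coordDist y′ z)) (cong (_+_ (suc g)) (sym (coordDist-fix y z x)))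
      where
      rearrange : ∀ d g c → d + suc (g + c) ≡ suc g + (c + d)
      rearrange = solve-∀

  dist-≀ : ∀ y x z x′ → dist W (y , x) (z , x′) ≡ ρ G (differences y z) x x′ + coordDist y z
  dist-≀ y x z x′ with ρ-attained G connected-G (differences y z) x x′
  ... | tour , D⊆tour = ≤-antisym (dist-minimal W ∈-verts-≀ via-tour) shortest-is-long
    where
    via-tour : LWalk W (ρ G (differences y z) x x′ + coordDist y z) (y , x) (z , x′)
    via-tour = lift tour y z D⊆tour
    shortest-is-long : ρ G (differences y z) x x′ + coordDist y z ≤ dist W (y , x) (z , x′)
    shortest-is-long with project (dist-attained W ∈-verts-≀ via-tour)
    ... | g , g+d≤ , q , D⊆q = ≤-trans (+-monoˡ-≤ (coordDist y z) (ρ-minimal G q D⊆q)) g+d≤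

  sumℕ-verts-≀ : ∀ (h : V W → ℕ) → sumℕ h (verts W) ≡ sumℕ (λ z → sumℕ (λ x′ → h (z , x′)) (allFin n)) (allVecs m n)
  sumℕ-verts-≀ h = trans (sumℕ-concatMap h (λ z → map (z ,_) (allFin n)) (allVecs m n))
                         (sumℕ-cong (allVecs m n) (λ z → sumℕ-map h (z ,_) (allFin n)))

  coordDist-total : ∀ y → sumℕ (coordDist y) (allVecs m n) ≡ m ^ n′ * sum (totalDist (toFG H) ∘ lookup y)
  coordDist-total y = begin
    sumℕ (coordDist y) (allVecs m n)
      ≡⟨ sumℕ-cong (allVecs m n) (λ z → sumℕ-allFin (λ j → dH (lookup y j) (lookup z j))) ⟨
    sumℕ (λ z → sumℕ (λ j → dH (lookup y j) (lookup z j)) (allFin n)) (allVecs m n)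
      ≡⟨ sumℕ-comm (λ z j → dH (lookup y j) (lookup z j)) (allVecs m n) (allFin n) ⟩
    sumℕ (λ j → sumℕ (λ z → dH (lookup y j) (lookup z j)) (allVecs m n)) (allFin n)
      ≡⟨ sumℕ-cong (allFin n) (λ j → sumℕ-allVecs-lookup m n′ j (dH (lookup y j))) ⟩
    sumℕ (λ j → m ^ n′ * totalDist (toFG H) (lookup y j)) (allFin n)
      ≡⟨ sumℕ-*ˡ (m ^ n′) (totalDist (toFG H) ∘ lookup y) (allFin n) ⟩
    m ^ n′ * sumℕ (totalDist (toFG H) ∘ lookup y) (allFin n)
      ≡⟨ cong (m ^ n′ *_) (sumℕ-allFin (totalDist (toFG H) ∘ lookup y)) ⟩
    m ^ n′ * sum (totalDist (toFG H) ∘ lookup y)                              ∎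
    where open ≡-Reasoning

  totalDist-≀ : ∀ y x → totalDist W (y , x) ≡ tourSum x + K * sum (totalDist (toFG H) ∘ lookup y)
  totalDist-≀ y x = begin
    totalDist W (y , x)
      ≡⟨ sumℕ-verts-≀ (dist W (y , x)) ⟩
    sumℕ (λ z → sumℕ (λ x′ → dist W (y , x) (z , x′)) (allFin n)) (allVecs m n)
      ≡⟨ sumℕ-cong (allVecs m n) (λ z → sumℕ-cong (allFin n) (dist-≀ y x z)) ⟩
    sumℕ (λ z → sumℕ (λ x′ → ρ G (differences y z) x x′ + coordDist y z) (allFin n)) (allVecs m n)
      ≡⟨ sumℕ-cong (allVecs m n) (λ z → trans (sumℕ-+ (ρ G (differences y z) x) (λ _ → coordDist y z) (allFin n))
                                             (cong (_+_ (sumℕ (ρ G (differences y z) x) (allFin n)))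
                                                   (trans (sumℕ-const (coordDist y z) (allFin n)) (cong (_* coordDist y z) (length-allFin n))))) ⟩
    sumℕ (λ z → sumℕ (ρ G (differences y z) x) (allFin n) + n * coordDist y z) (allVecs m n)
      ≡⟨ sumℕ-+ (λ z → sumℕ (ρ G (differences y z) x) (allFin n)) (λ z → n * coordDist y z) (allVecs m n) ⟩
    sumℕ (λ z → sumℕ (ρ G (differences y z) x) (allFin n)) (allVecs m n) + sumℕ (λ z → n * coordDist y z) (allVecs m n)
      ≡⟨ cong₂ _+_ (sumℕ-differences m′ n y (λ A → sumℕ (ρ G A x) (allFin n)))
                   (trans (sumℕ-*ˡ n (coordDist y) (allVecs m n)) (cong (n *_) (coordDist-total y))) ⟩
    tourSum x + n * (m ^ n′ * sum (totalDist (toFG H) ∘ lookup y))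
      ≡⟨ cong (_+_ (tourSum x)) (*-assoc n (m ^ n′) _) ⟨
    tourSum x + K * sum (totalDist (toFG H) ∘ lookup y) ∎
    where open ≡-Reasoning

  Wcount-split : ∀ u v →
    Wcount W u v ≡ sumℕ (λ z → sumℕ (λ x′ → indicator (dist W (z , x′) u <ᵇ dist W (z , x′) v)) (allFin n)) (allVecs m n)
  Wcount-split u v = trans (count-sumℕ (λ w → dist W w u <ᵇ dist W w v) (verts W)) (sumℕ-verts-≀ _)

  Wcount-≀-base : ∀ y i k → Wcount W (y , i) (y , k) ≡ winSum i k
  Wcount-≀-base y i k = begin
    Wcount W (y , i) (y , k)
      ≡⟨ Wcount-split (y , i) (y , k) ⟩
    sumℕ (λ z → sumℕ (λ x′ → indicator (dist W (z , x′) (y , i) <ᵇ dist W (z , x′) (y , k))) (allFin n)) (allVecs m n)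
      ≡⟨ sumℕ-cong (allVecs m n) (λ z → trans (sumℕ-cong (allFin n) (λ x′ → cong indicator (closer z x′)))
                                             (sym (count-sumℕ (winner (differences y z)) (allFin n)))) ⟩
    sumℕ (λ z → count (winner (differences y z)) (allFin n)) (allVecs m n)
      ≡⟨ sumℕ-differences m′ n y (λ A → count (winner A) (allFin n)) ⟩
    winSum i k ∎
    where
    open ≡-Reasoning
    winner : Subset n → Fin n → Bool
    winner A x′ = ρ G A x′ i <ᵇ ρ G A x′ k
    shift : ∀ a b c → a + c + b ≡ b + c + a
    shift = solve-∀
    closer : ∀ z x′ → (dist W (z , x′) (y , i) <ᵇ dist W (z , x′) (y , k)) ≡ winner (differences y z) x′
    closer z x′ =
      trans (cong₂ _<ᵇ_ (dist-≀ z x′ y i) (dist-≀ z x′ y k)) (trans step (cong (λ A → winner A x′) (differences-comm z y)))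
      where
      D : Subset n
      D = differences z y
      step : (ρ G D x′ i + coordDist z y <ᵇ ρ G D x′ k + coordDist z y) ≡ (ρ G D x′ i <ᵇ ρ G D x′ k)
      step = <ᵇ-shift (ρ G D x′ i + coordDist z y) (ρ G D x′ k + coordDist z y) (ρ G D x′ i) (ρ G D x′ k)
               (shift (ρ G D x′ i) (ρ G D x′ k) (coordDist z y))

  Wcount-≀-fibre : ∀ y y′ i → AgreeOff i y y′ → Wcount W (y , i) (y′ , i) ≡ K * Wcount (toFG H) (lookup y i) (lookup y′ i)
  Wcount-≀-fibre y y′ i y≈y′ = begin
    Wcount W (y , i) (y′ , i)
      ≡⟨ Wcount-split (y , i) (y′ , i) ⟩
    sumℕ (λ z → sumℕ (λ x′ → indicator (dist W (z , x′) (y , i) <ᵇ dist W (z , x′) (y′ , i))) (allFin n)) (allVecs m n)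
      ≡⟨ sumℕ-cong (allVecs m n) (λ z → trans (sumℕ-cong (allFin n) (λ x′ → cong indicator (closer z x′)))
                                             (trans (sumℕ-const (P (lookup z i)) (allFin n)) (cong (_* P (lookup z i)) (length-allFin n)))) ⟩
    sumℕ (λ z → n * P (lookup z i)) (allVecs m n)          ≡⟨ sumℕ-*ˡ n (P ∘ (λ z → lookup z i)) (allVecs m n) ⟩
    n * sumℕ (λ z → P (lookup z i)) (allVecs m n)          ≡⟨ cong (n *_) (sumℕ-allVecs-lookup m n′ i P) ⟩
    n * (m ^ n′ * sumℕ P (allFin m))                       ≡⟨ *-assoc n (m ^ n′) _ ⟨
    K * sumℕ P (allFin m)                                  ≡⟨ cong (K *_) (count-sumℕ _ (allFin m)) ⟨
    K * Wcount (toFG H) (lookup y i) (lookup y′ i)         ∎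
    where
    open ≡-Reasoning
    P : Fin m → ℕ
    P b = indicator (dH b (lookup y i) <ᵇ dH b (lookup y′ i))
    same-tour : ∀ z x′ → ρ G (differences z y) x′ i ≡ ρ G (differences z y′) x′ i
    same-tour z x′ = ≤-antisym (ρ-mono-end G connected-G x′ i (differences-agree z y≈y′))
                               (ρ-mono-end G connected-G x′ i (differences-agree z (λ j j≢i → sym (y≈y′ j j≢i))))
    closer : ∀ z x′ → (dist W (z , x′) (y , i) <ᵇ dist W (z , x′) (y′ , i))
                       ≡ (dH (lookup z i) (lookup y i) <ᵇ dH (lookup z i) (lookup y′ i))
    closer z x′ =
      trans (cong₂ _<ᵇ_ (dist-≀ z x′ y i) (dist-≀ z x′ y′ i))
        (trans (cong (λ r → r + coordDist z y <ᵇ ρ G (differences z y′) x′ i + coordDist z y′) (same-tour z x′)) step)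
      where
      r c d : ℕ
      r = ρ G (differences z y′) x′ i
      c = dH (lookup z i) (lookup y i)
      d = dH (lookup z i) (lookup y′ i)
      agree : coordDist z y + d ≡ coordDist z y′ + c
      agree = sum-agree-off (λ j → dH (lookup z j) (lookup y j)) (λ j → dH (lookup z j) (lookup y′ j)) i
                            (λ j j≢i → cong (dH (lookup z j)) (y≈y′ j j≢i))
      step : (r + coordDist z y <ᵇ r + coordDist z y′) ≡ (c <ᵇ d)
      step = <ᵇ-shift (r + coordDist z y) (r + coordDist z y′) c d
               (trans (+-assoc r (coordDist z y) d) (trans (cong (_+_ r) agree) (sym (+-assoc r (coordDist z y′) c))))

  private
    instance
      K-nonZero : NonZero K
      K-nonZero = m*n≢0 n (m ^ n′) {{_}} {{m^n≢0 m n′}}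

  private
    ΣH : Vec (Fin m) n → ℕ
    ΣH y = sum (totalDist (toFG H) ∘ lookup y)

  totalDist-minimal-≀ : ∀ ys x → IsMedian W (ys , x) ⇔ (∀ y′ x′ → tourSum x + K * ΣH ys ≤ tourSum x′ + K * ΣH y′)
  totalDist-minimal-≀ ys x = mk⇔ to from
    where
    median⇔ : IsMedian W (ys , x) ⇔ (∀ v → totalDist W (ys , x) ≤ totalDist W v)
    median⇔ = IsMedian⇔ W (∈-verts-≀ (ys , x)) (ys , x)
    to : IsMedian W (ys , x) → ∀ y′ x′ → tourSum x + K * ΣH ys ≤ tourSum x′ + K * ΣH y′
    to med y′ x′ = subst₂ _≤_ (totalDist-≀ ys x) (totalDist-≀ y′ x′) (Equivalence.to median⇔ med (y′ , x′))
    from : (∀ y′ x′ → tourSum x + K * ΣH ys ≤ tourSum x′ + K * ΣH y′) → IsMedian W (ys , x)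
    from min = Equivalence.from median⇔ minimal
      where
      minimal : ∀ v → totalDist W (ys , x) ≤ totalDist W v
      minimal (y′ , x′) = subst₂ _≤_ (sym (totalDist-≀ ys x)) (sym (totalDist-≀ y′ x′)) (min y′ x′)

  median-≀ : ∀ ys x → IsMedian W (ys , x) ⇔ ((∀ j → IsMedian (toFG H) (lookup ys j)) × IsPTSMedian G (+ m′ / suc m′) x)
  median-≀ ys x = mk⇔ to from
    where
    S : Fin m → ℕ
    S = totalDist (toFG H)
    separable : (∀ y′ x′ → tourSum x + K * ΣH ys ≤ tourSum x′ + K * ΣH y′)
                  ⇔ ((∀ j b → S (lookup ys j) ≤ S b) × (∀ x′ → tourSum x ≤ tourSum x′))
    separable = separable-minimum tourSum S K ys x
    medianH : ∀ j → IsMedian (toFG H) (lookup ys j) ⇔ (∀ b → S (lookup ys j) ≤ S b)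
    medianH j = IsMedian⇔ (toFG H) (∈-allFin (lookup ys j)) (lookup ys j)
    to : IsMedian W (ys , x) → (∀ j → IsMedian (toFG H) (lookup ys j)) × IsPTSMedian G (+ m′ / suc m′) x
    to med = (λ j → Equivalence.from (medianH j) (proj₁ parts j)) , Equivalence.from (IsPTSMedian⇔ x) (proj₂ parts)
      where
      parts : (∀ j b → S (lookup ys j) ≤ S b) × (∀ x′ → tourSum x ≤ tourSum x′)
      parts = Equivalence.to separable (Equivalence.to (totalDist-minimal-≀ ys x) med)
    from : (∀ j → IsMedian (toFG H) (lookup ys j)) × IsPTSMedian G (+ m′ / suc m′) x → IsMedian W (ys , x)
    from (H-med , G-med) = Equivalence.from (totalDist-minimal-≀ ys x)
      (Equivalence.from separable ((λ j → Equivalence.to (medianH j) (H-med j)) , Equivalence.to (IsPTSMedian⇔ x) G-med))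

  balanced-≀⁻ : DistanceBalanced W → PTSDistanceBalanced G (+ m′ / suc m′) × DistanceBalanced (toFG H)
  balanced-≀⁻ bal = Equivalence.from PTSDistanceBalanced⇔ G-bal , H-bal
    where
    y₀ : Vec (Fin m) n
    y₀ = Vec.replicate n F.zero
    G-bal : ∀ i k → adj G i k ≡ true → winSum i k ≡ winSum k i
    G-bal i k e = trans (sym (Wcount-≀-base y₀ i k)) (trans (bal (y₀ , i) (y₀ , k) (adj-base y₀ e)) (Wcount-≀-base y₀ k i))
    H-bal : DistanceBalanced (toFG H)
    H-bal a b e = *-cancelˡ-≡ _ _ K (begin
      K * Wcount (toFG H) a b              ≡⟨ Wcount-≀-fibre y y′ F.zero (AgreeOff-update y F.zero b) ⟨
      Wcount W (y , F.zero) (y′ , F.zero)  ≡⟨ bal (y , F.zero) (y′ , F.zero) (adj-fibre y F.zero e) ⟩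
      Wcount W (y′ , F.zero) (y , F.zero)  ≡⟨ Wcount-≀-fibre y′ y F.zero (λ j j≢0 → sym (AgreeOff-update y F.zero b j j≢0)) ⟩
      K * Wcount (toFG H) b a              ∎)
      where
      open ≡-Reasoning
      y y′ : Vec (Fin m) n
      y = Vec.replicate n a
      y′ = y [ F.zero ]≔ b

  balanced-≀⁺ : PTSDistanceBalanced G (+ m′ / suc m′) × DistanceBalanced (toFG H) → DistanceBalanced W
  balanced-≀⁺ (G-bal , H-bal) (y , i) (z , k) e = balanced-edge y i z k (adj⁻ y i z k e)
    where
    balanced-edge : ∀ y i z k →
                    (i ≡ k × AgreeOff i y z × adj H (lookup y i) (lookup z i) ≡ true) ⊎ (y ≡ z × adj G i k ≡ true) →
                    Wcount W (y , i) (z , k) ≡ Wcount W (z , k) (y , i)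
    balanced-edge y i z .i (inj₁ (refl , y≈z , e-H)) = begin
      Wcount W (y , i) (z , i)                        ≡⟨ Wcount-≀-fibre y z i y≈z ⟩
      K * Wcount (toFG H) (lookup y i) (lookup z i)   ≡⟨ cong (K *_) (H-bal (lookup y i) (lookup z i) e-H) ⟩
      K * Wcount (toFG H) (lookup z i) (lookup y i)   ≡⟨ Wcount-≀-fibre z y i (λ j j≢i → sym (y≈z j j≢i)) ⟨
      Wcount W (z , i) (y , i)                        ∎
      where open ≡-Reasoning
    balanced-edge y i .y k (inj₂ (refl , e-G)) = begin
      Wcount W (y , i) (y , k)   ≡⟨ Wcount-≀-base y i k ⟩
      winSum i k                 ≡⟨ Equivalence.to PTSDistanceBalanced⇔ G-bal i k e-G ⟩
      winSum k i                 ≡⟨ Wcount-≀-base y k i ⟨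
      Wcount W (y , k) (y , i)   ∎
      where open ≡-Reasoning

theorem3p4 : ∀ {n' m' : ℕ} (G : SimpleGraph (suc n')) (H : SimpleGraph (suc m'))
  → Connected (toFG G) → Connected (toFG H)
  → ((ys : Vec (Fin (suc m')) (suc n')) (x : Fin (suc n'))
       → IsMedian (G ≀ H) (ys , x)
         ⇔ ((∀ j → IsMedian (toFG H) (lookup ys j)) × IsPTSMedian G (+ m' / suc m') x))
    × (DistanceBalanced (G ≀ H)
         ⇔ (PTSDistanceBalanced G (+ m' / suc m') × DistanceBalanced (toFG H)))
theorem3p4 G H connected-G connected-H = median-≀ , mk⇔ balanced-≀⁻ balanced-≀⁺
  where open Wreath G H connected-G connected-H
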